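{- Let $WTILE$ and $ILL$ be the index sets defined below. Then $WTILE\equiv_m ILL$.
   Context: $\varphi_e$ denotes the $e$-th partial computable function; $\equiv_m$ is many-one equivalence. A Wang prototile is a 4-tuple $\langle l,u,r,b\rangle$ of colours (natural numbers) for the left, upper, right and bottom quarters of a diagonally quadrisected unit square; prototile sets are identified with sets of codes. For a set $S$ of Wang prototiles and $R\subseteq\mathbb{Z}^2$, an $S$-tiling of $R$ is a map $f:R\to S$ such that for horizontally adjacent $(x,y),(x+1,y)\in R$ the right colour of $f(x,y)$ equals the left colour of $f(x+1,y)$, and for vertically adjacent $(x,y),(x,y+1)\in R$ the upper colour of $f(x,y)$ equals the bottom colour of $f(x,y+1)$ (no rotations). $WTILE=\{e:\varphi_e$ is the characteristic function of a set $S$ of Wang prototiles which has an $S$-tiling of some infinite region $R\subseteq\mathbb{Z}^2$ that is connected in the grid graph (not necessarily all of $\mathbb{Z}^2$)$\}$. A tree is a subset of $\omega^{<\omega}$ closed under initial segments; $ILL=\{e:\varphi_e$ is the characteristic function of a tree $T\subseteq\omega^{<\omega}$ with an infinite path$\}$. -}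

module Defs where

open import Level using (0ℓ)
open import Data.Nat using (ℕ; zero; suc; _+_)
open import Data.Fin using (Fin; toℕ)
open import Data.Integer as ℤ using (ℤ)
open import Data.Vec using (Vec; []; _∷_)
open import Data.List using (List; []; _∷_; _++_)
open import Data.List.Membership.Propositional using (_∉_)
open import Data.Product using (Σ; ∃; _×_; _,_)
open import Data.Sum using (_⊎_)
open import Relation.Unary using (Pred)
open import Relation.Binary.PropositionalEquality using (_≡_)

tri : ℕ → ℕ
tri zero    = 0
tri (suc n) = suc n + tri n

pair : ℕ → ℕ → ℕ
pair a b = tri (a + b) + b

⌜_⌝ : List ℕ → ℕ
⌜ [] ⌝    = 0
⌜ a ∷ σ ⌝ = suc (pair a ⌜ σ ⌝)

data PR : ℕ → Set where
  Z    : ∀ {n} → PR n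
  S    : PR 1
  P    : ∀ {n} → Fin n → PR n
  comp : ∀ {m n} → PR m → Vec (PR n) m → PR n
  rec  : ∀ {n} → PR n → PR (suc (suc n)) → PR (suc n)
  mu   : ∀ {n} → PR (suc n) → PR n

lookupV : ∀ {n} → Vec ℕ n → Fin n → ℕ
lookupV (x ∷ xs) Fin.zero    = x
lookupV (x ∷ xs) (Fin.suc i) = lookupV xs i

-- big-step semantics:  Eval f xs y  means  f(xs) is defined and equals y
mutual
  data Eval : ∀ {n} → PR n → Vec ℕ n → ℕ → Set where
    evZ    : ∀ {n} {xs : Vec ℕ n} → Eval Z xs 0
    evS    : ∀ {x} → Eval S (x ∷ []) (suc x)
    evP    : ∀ {n} {xs : Vec ℕ n} (i : Fin n) → Eval (P i) xs (lookupV xs i)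
    evComp : ∀ {m n} {f : PR m} {gs : Vec (PR n) m} {xs ys y} →
             EvalVec gs xs ys → Eval f ys y → Eval (comp f gs) xs y
    evRec0 : ∀ {n} {g : PR n} {h : PR (suc (suc n))} {xs y} →
             Eval g xs y → Eval (rec g h) (0 ∷ xs) y
    evRecS : ∀ {n} {g : PR n} {h : PR (suc (suc n))} {k xs r y} →
             Eval (rec g h) (k ∷ xs) r → Eval h (k ∷ r ∷ xs) y →
             Eval (rec g h) (suc k ∷ xs) y
    evMu   : ∀ {n} {f : PR (suc n)} {xs y} →
             MuSearch f xs 0 y → Eval (mu f) xs y

  data EvalVec : ∀ {m n} → Vec (PR n) m → Vec ℕ n → Vec ℕ m → Set where
    []  : ∀ {n} {xs : Vec ℕ n} → EvalVec [] xs []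
    _∷_ : ∀ {m n} {g : PR n} {gs : Vec (PR n) m} {xs y ys} →
          Eval g xs y → EvalVec gs xs ys → EvalVec (g ∷ gs) xs (y ∷ ys)

  -- MuSearch f xs k y : y is the least z ≥ k with f(z,xs) = 0,
  -- and f(z,xs) is defined (and nonzero) for all k ≤ z < y
  data MuSearch : ∀ {n} → PR (suc n) → Vec ℕ n → ℕ → ℕ → Set where
    found : ∀ {n} {f : PR (suc n)} {xs k} →
            Eval f (k ∷ xs) 0 → MuSearch f xs k k
    next  : ∀ {n} {f : PR (suc n)} {xs k v y} →
            Eval f (k ∷ xs) (suc v) → MuSearch f xs (suc k) y → MuSearch f xs k y

mutual
  enc : ∀ {n} → PR n → ℕ
  enc {n} c = pair n (raw c)

  raw : ∀ {n} → PR n → ℕ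
  raw Z          = pair 0 0
  raw S          = pair 1 0
  raw (P i)      = pair 2 (toℕ i)
  raw (comp f gs) = pair 3 (pair (enc f) (encVec gs))
  raw (rec g h)  = pair 4 (pair (enc g) (enc h))
  raw (mu f)     = pair 5 (enc f)

  encVec : ∀ {m n} → Vec (PR n) m → ℕ
  encVec []       = 0
  encVec (g ∷ gs) = suc (pair (enc g) (encVec gs))

-- φ_e(x) ≃ y  (numbers that are not codes of unary programs give the
-- nowhere-defined function)
Φ : ℕ → ℕ → ℕ → Set
Φ e x y = Σ (PR 1) λ c → enc c ≡ e × Eval c (x ∷ []) y

IsCharFn : ℕ → Set
IsCharFn e = ∀ x → Φ e x 0 ⊎ Φ e x 1

Set[_] : ℕ → Pred ℕ 0ℓ
Set[ e ] x = Φ e x 1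

Computable : (ℕ → ℕ) → Set
Computable f = Σ (PR 1) λ c → ∀ x → Eval c (x ∷ []) (f x)

_≤m_ : ∀ {a b} → Pred ℕ a → Pred ℕ b → Set _
A ≤m B = Σ (ℕ → ℕ) λ f → Computable f × (∀ x → (A x → B (f x)) × (B (f x) → A x))

_≡m_ : ∀ {a b} → Pred ℕ a → Pred ℕ b → Set _
A ≡m B = (A ≤m B) × (B ≤m A)

record Tile : Set where
  constructor ⟨_,_,_,_⟩
  field left up right bottom : ℕ
open Tile public

tileCode : Tile → ℕ
tileCode ⟨ l , u , r , b ⟩ = pair l (pair u (pair r b))

Point : Set
Point = ℤ × ℤ

Adj : Point → Point → Set
Adj (x , y) (x' , y') =
    (x' ≡ x ℤ.+ ℤ.1ℤ × y' ≡ y) ⊎ (x ≡ x' ℤ.+ ℤ.1ℤ × y' ≡ y)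
  ⊎ (x' ≡ x × y' ≡ y ℤ.+ ℤ.1ℤ) ⊎ (x' ≡ x × y ≡ y' ℤ.+ ℤ.1ℤ)

data GridPath (R : Pred Point 0ℓ) : Point → Point → Set where
  here : ∀ {p} → R p → GridPath R p p
  step : ∀ {p p' q} → R p → Adj p p' → GridPath R p' q → GridPath R p q

Connected : Pred Point 0ℓ → Set
Connected R = ∀ p q → R p → R q → GridPath R p q

Infinite : Pred Point 0ℓ → Set
Infinite R = ∀ (l : List Point) → ∃ λ p → R p × p ∉ l

IsTiling : Pred ℕ 0ℓ → (R : Pred Point 0ℓ) → ((p : Point) → R p → Tile) → Set
IsTiling Sₜ R f =
    (∀ p (r : R p) → Sₜ (tileCode (f p r)))
  × (∀ x y (r : R (x , y)) (r' : R (x ℤ.+ ℤ.1ℤ , y)) →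
       right (f (x , y) r) ≡ left (f (x ℤ.+ ℤ.1ℤ , y) r'))
  × (∀ x y (r : R (x , y)) (r' : R (x , y ℤ.+ ℤ.1ℤ)) →
       up (f (x , y) r) ≡ bottom (f (x , y ℤ.+ ℤ.1ℤ) r'))

TilesInfiniteConnected : Pred ℕ 0ℓ → Set₁
TilesInfiniteConnected Sₜ =
  Σ (Pred Point 0ℓ) λ R → Infinite R × Connected R ×
    Σ ((p : Point) → R p → Tile) λ f → IsTiling Sₜ R f

WTILE : Pred ℕ (Level.suc 0ℓ)
WTILE e = IsCharFn e × TilesInfiniteConnected Set[ e ]

IsTree : Pred ℕ 0ℓ → Set
IsTree T = ∀ (σ τ : List ℕ) → T ⌜ σ ++ τ ⌝ → T ⌜ σ ⌝

restrict : (ℕ → ℕ) → ℕ → List ℕ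
restrict g zero    = []
restrict g (suc n) = restrict g n ++ (g n ∷ [])

HasInfinitePath : Pred ℕ 0ℓ → Set
HasInfinitePath T = Σ (ℕ → ℕ) λ g → ∀ n → T ⌜ restrict g n ⌝

ILL : Pred ℕ 0ℓ
ILL e = IsCharFn e × IsTree Set[ e ] × HasInfinitePath Set[ e ]

-- Both reductions have the same shape. A program M with an oracle hole turns an index e of a
-- characteristic function χ into an index of x ↦ M^χ(x), guarded so that the map also reflects
-- being an index of a characteristic function; M is chosen so that the relevant property of the set
-- {x | χ x = 1} is equivalent to the other property of {x | M^χ x = 1}.
--
-- ILL ≤m WTILE. A tree T goes to the tiles ⟨ σ , 1 + a , σa , 0 ⟩ with σa ∈ T. No such tile fits on
-- top of another, so an infinite connected tiled region is a horizontal ray along which the left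
-- colours σ grow by one letter at each step, and these letters spell an infinite branch of T;
-- conversely an infinite branch tiles a row. To recover that T is a tree, a tile is admitted only if
-- T is closed under prefixes below its code.
--
-- WTILE ≤m ILL. A tile set S goes to the tree of finite sequences of entries (point , tile) in which
-- every tile is in S and every entry lies at a new point, is adjacent to an earlier entry (unless it
-- is the first) and matches the colours of its earlier neighbours. An infinite branch tiles the
-- connected region it enumerates, and that region is infinite as its points are distinct. Conversely
-- an infinite connected tiled region can be enumerated in this way, because a path from a visited
-- point to an unvisited one must leave the visited part through an unvisited neighbour.

module Submission where

open import Defs

module Coding where

  open import Data.Nat
  open import Data.Nat.Properties
  open import Data.Product using (_×_; _,_; proj₁; proj₂; uncurry)
  open import Data.List using (List; []; _∷_; length)
  open import Function using (_∘′_)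
  open import Relation.Binary.PropositionalEquality

  tri-mono-≤ : ∀ {m n} → m ≤ n → tri m ≤ tri n
  tri-mono-≤ {zero}          z≤n     = z≤n
  tri-mono-≤ {suc m} {suc n} (s≤s p) = +-mono-≤ (s≤s p) (tri-mono-≤ p)

  n≤tri[n] : ∀ n → n ≤ tri n
  n≤tri[n] zero    = z≤n
  n≤tri[n] (suc n) = m≤m+n (suc n) (tri n)

  tri[a+b]≤pair : ∀ a b → tri (a + b) ≤ pair a b
  tri[a+b]≤pair a b = m≤m+n _ _

  pair<tri[1+a+b] : ∀ a b → pair a b < tri (suc (a + b))
  pair<tri[1+a+b] a b = begin-strict
    tri (a + b) + b             ≤⟨ +-monoʳ-≤ (tri (a + b)) (m≤n+m b a) ⟩
    tri (a + b) + (a + b)       <⟨ n<1+n _ ⟩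
    suc (tri (a + b) + (a + b)) ≡⟨ cong suc (+-comm (tri (a + b)) (a + b)) ⟩
    tri (suc (a + b))           ∎
    where open ≤-Reasoning

  a≤pair : ∀ a b → a ≤ pair a b
  a≤pair a b = ≤-trans (m≤m+n a b) (≤-trans (n≤tri[n] (a + b)) (tri[a+b]≤pair a b))

  b≤pair : ∀ a b → b ≤ pair a b
  b≤pair a b = m≤n+m b _

  pair-suc-right : ∀ a b → pair a (suc b) ≡ suc (pair (suc a) b)
  pair-suc-right a b = begin
    tri (a + suc b) + suc b   ≡⟨ cong (λ s → tri s + suc b) (+-suc a b) ⟩
    tri (suc a + b) + suc b   ≡⟨ +-suc (tri (suc a + b)) b ⟩
    suc (tri (suc a + b) + b) ∎
    where open ≡-Reasoning

  pair-suc-zero : ∀ a → pair (suc a) 0 ≡ suc (pair 0 a)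
  pair-suc-zero a = begin
    tri (suc a + 0) + 0 ≡⟨ +-identityʳ _ ⟩
    tri (suc a + 0)     ≡⟨ cong (tri ∘′ suc) (+-identityʳ a) ⟩
    suc (a + tri a)     ≡⟨ cong suc (+-comm a (tri a)) ⟩
    suc (tri a + a)     ∎
    where open ≡-Reasoning

  -- Cantor's enumeration walks each diagonal from (s , 0) up to (0 , s).
  unpair-step : ℕ × ℕ → ℕ × ℕ
  unpair-step (zero  , b) = suc b , 0
  unpair-step (suc a , b) = a , suc b

  unpair : ℕ → ℕ × ℕ
  unpair zero    = 0 , 0
  unpair (suc w) = unpair-step (unpair w)

  fst snd : ℕ → ℕ
  fst w = proj₁ (unpair w)
  snd w = proj₂ (unpair w)

  pair-unpair-step : ∀ p → uncurry pair (unpair-step p) ≡ suc (uncurry pair p)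
  pair-unpair-step (zero  , b) = pair-suc-zero b
  pair-unpair-step (suc a , b) = pair-suc-right a b

  pair-fst-snd : ∀ w → pair (fst w) (snd w) ≡ w
  pair-fst-snd zero    = refl
  pair-fst-snd (suc w) = trans (pair-unpair-step (unpair w)) (cong suc (pair-fst-snd w))

  unpair-pair : ∀ a b → unpair (pair a b) ≡ (a , b)
  unpair-pair a b = go (a + b) b a refl
    where
    go : ∀ s b a → a + b ≡ s → unpair (pair a b) ≡ (a , b)
    go s       (suc b) a       eq = subst (λ w → unpair w ≡ (a , suc b)) (sym (pair-suc-right a b))
      (cong unpair-step (go s b (suc a) (trans (sym (+-suc a b)) eq)))
    go _       zero    zero    _  = refl
    go (suc s) zero    (suc a) eq = subst (λ w → unpair w ≡ (suc a , 0)) (sym (pair-suc-zero a))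
      (cong unpair-step (go s a 0 (suc-injective (trans (sym (+-identityʳ (suc a))) eq))))

  fst-pair : ∀ a b → fst (pair a b) ≡ a
  fst-pair a b = cong proj₁ (unpair-pair a b)

  snd-pair : ∀ a b → snd (pair a b) ≡ b
  snd-pair a b = cong proj₂ (unpair-pair a b)

  pair-injectiveˡ : ∀ {a b a′ b′} → pair a b ≡ pair a′ b′ → a ≡ a′
  pair-injectiveˡ {a} {b} {a′} {b′} eq = trans (sym (fst-pair a b)) (trans (cong fst eq) (fst-pair a′ b′))

  pair-injectiveʳ : ∀ {a b a′ b′} → pair a b ≡ pair a′ b′ → b ≡ b′
  pair-injectiveʳ {a} {b} {a′} {b′} eq = trans (sym (snd-pair a b)) (trans (cong snd eq) (snd-pair a′ b′))

  snd≤ : ∀ w → snd w ≤ w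
  snd≤ w = subst (snd w ≤_) (pair-fst-snd w) (b≤pair (fst w) (snd w))

  -- The fuel argument bounds the length of the decoded list; the code itself suffices.
  decodeWithin : ℕ → ℕ → List ℕ
  decodeWithin zero     _       = []
  decodeWithin (suc f)  zero    = []
  decodeWithin (suc f)  (suc w) = fst w ∷ decodeWithin f (snd w)

  decode : ℕ → List ℕ
  decode w = decodeWithin w w

  ⌜decodeWithin⌝ : ∀ f w → w ≤ f → ⌜ decodeWithin f w ⌝ ≡ w
  ⌜decodeWithin⌝ zero    .zero   z≤n      = refl
  ⌜decodeWithin⌝ (suc f) zero    _        = refl
  ⌜decodeWithin⌝ (suc f) (suc w) (s≤s w≤f) = cong suc (begin
    pair (fst w) ⌜ decodeWithin f (snd w) ⌝
      ≡⟨ cong (pair (fst w)) (⌜decodeWithin⌝ f (snd w) (≤-trans (snd≤ w) w≤f)) ⟩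
    pair (fst w) (snd w)
      ≡⟨ pair-fst-snd w ⟩
    w ∎)
    where open ≡-Reasoning

  ⌜decode⌝ : ∀ w → ⌜ decode w ⌝ ≡ w
  ⌜decode⌝ w = ⌜decodeWithin⌝ w w ≤-refl

  ⌜⌝-injective : ∀ {σ τ} → ⌜ σ ⌝ ≡ ⌜ τ ⌝ → σ ≡ τ
  ⌜⌝-injective {[]}    {[]}    _  = refl
  ⌜⌝-injective {a ∷ σ} {b ∷ τ} eq = cong₂ _∷_
    (pair-injectiveˡ {a} {⌜ σ ⌝} {b} {⌜ τ ⌝} (suc-injective eq))
    (⌜⌝-injective (pair-injectiveʳ {a} {⌜ σ ⌝} {b} {⌜ τ ⌝} (suc-injective eq)))

  decode-⌜⌝ : ∀ σ → decode ⌜ σ ⌝ ≡ σ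
  decode-⌜⌝ σ = ⌜⌝-injective (⌜decode⌝ ⌜ σ ⌝)

  decodeWithin-decode : ∀ f w → w ≤ f → decodeWithin f w ≡ decode w
  decodeWithin-decode f w w≤f = ⌜⌝-injective (trans (⌜decodeWithin⌝ f w w≤f) (sym (⌜decode⌝ w)))

  length≤⌜⌝ : ∀ σ → length σ ≤ ⌜ σ ⌝
  length≤⌜⌝ []      = z≤n
  length≤⌜⌝ (a ∷ σ) = s≤s (≤-trans (length≤⌜⌝ σ) (b≤pair a ⌜ σ ⌝))

  length-decode≤ : ∀ w → length (decode w) ≤ w
  length-decode≤ w = subst (length (decode w) ≤_) (⌜decode⌝ w) (length≤⌜⌝ (decode w))

  decodeTile : ℕ → Tile
  decodeTile x = ⟨ fst x , fst (snd x) , fst (snd (snd x)) , snd (snd (snd x)) ⟩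

  decodeTile-tileCode : ∀ t → decodeTile (tileCode t) ≡ t
  decodeTile-tileCode ⟨ l , u , r , b ⟩
    rewrite fst-pair l (pair u (pair r b)) | snd-pair l (pair u (pair r b))
          | fst-pair u (pair r b) | snd-pair u (pair r b) | fst-pair r b | snd-pair r b = refl

  tileCode-decodeTile : ∀ x → tileCode (decodeTile x) ≡ x
  tileCode-decodeTile x = begin
    pair (fst x) (pair (fst (snd x)) (pair (fst (snd (snd x))) (snd (snd (snd x)))))
      ≡⟨ cong (λ v → pair (fst x) (pair (fst (snd x)) v)) (pair-fst-snd (snd (snd x))) ⟩
    pair (fst x) (pair (fst (snd x)) (snd (snd x)))
      ≡⟨ cong (pair (fst x)) (pair-fst-snd (snd x)) ⟩
    pair (fst x) (snd x)
      ≡⟨ pair-fst-snd x ⟩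
    x ∎
    where open ≡-Reasoning

module Programs where

  open Coding
  open import Data.Nat
  open import Data.Nat.Properties using (suc-injective)
  open import Data.Fin using (Fin; toℕ)
  open import Data.Fin.Properties using (toℕ-injective)
  open import Data.Vec using (Vec; []; _∷_)
  open import Data.Product using (Σ; _×_; _,_; proj₁; proj₂)
  open import Relation.Binary.PropositionalEquality

  mutual
    Eval-deterministic : ∀ {n} {f : PR n} {xs y y′} → Eval f xs y → Eval f xs y′ → y ≡ y′
    Eval-deterministic evZ        evZ          = refl
    Eval-deterministic evS        evS          = refl
    Eval-deterministic (evP i)    (evP .i)     = refl
    Eval-deterministic (evComp a b) (evComp a′ b′) with EvalVec-deterministic a a′
    ... | refl = Eval-deterministic b b′
    Eval-deterministic (evRec0 a) (evRec0 a′)  = Eval-deterministic a a′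
    Eval-deterministic (evRecS a b) (evRecS a′ b′) with Eval-deterministic a a′
    ... | refl = Eval-deterministic b b′
    Eval-deterministic (evMu a)   (evMu a′)    = MuSearch-deterministic a a′

    EvalVec-deterministic : ∀ {m n} {gs : Vec (PR n) m} {xs ys ys′} →
                            EvalVec gs xs ys → EvalVec gs xs ys′ → ys ≡ ys′
    EvalVec-deterministic []       []         = refl
    EvalVec-deterministic (a ∷ as) (a′ ∷ as′) =
      cong₂ _∷_ (Eval-deterministic a a′) (EvalVec-deterministic as as′)

    MuSearch-deterministic : ∀ {n} {f : PR (suc n)} {xs k y y′} →
                             MuSearch f xs k y → MuSearch f xs k y′ → y ≡ y′
    MuSearch-deterministic (found _)  (found _)   = refl
    MuSearch-deterministic (found a)  (next a′ _) with Eval-deterministic a a′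
    ... | ()
    MuSearch-deterministic (next a _) (found a′)  with Eval-deterministic a a′
    ... | ()
    MuSearch-deterministic (next _ b) (next _ b′) = MuSearch-deterministic b b′

  data Ctx : ℕ → Set where
    Z    : ∀ {n} → Ctx n
    S    : Ctx 1
    P    : ∀ {n} → Fin n → Ctx n
    comp : ∀ {m n} → Ctx m → Vec (Ctx n) m → Ctx n
    rec  : ∀ {n} → Ctx n → Ctx (suc (suc n)) → Ctx (suc n)
    mu   : ∀ {n} → Ctx (suc n) → Ctx n
    hole : Ctx 1

  mutual
    fill : ∀ {n} → Ctx n → PR 1 → PR n
    fill Z           c = Z
    fill S           c = S
    fill (P i)       c = P i
    fill (comp f gs) c = comp (fill f c) (fillVec gs c)
    fill (rec g h)   c = rec (fill g c) (fill h c)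
    fill (mu f)      c = mu (fill f c)
    fill hole        c = c

    fillVec : ∀ {m n} → Vec (Ctx n) m → PR 1 → Vec (PR n) m
    fillVec []       c = []
    fillVec (g ∷ gs) c = fill g c ∷ fillVec gs c

  mutual
    toCtx : ∀ {n} → PR n → Ctx n
    toCtx Z           = Z
    toCtx S           = S
    toCtx (P i)       = P i
    toCtx (comp f gs) = comp (toCtx f) (toCtxVec gs)
    toCtx (rec g h)   = rec (toCtx g) (toCtx h)
    toCtx (mu f)      = mu (toCtx f)

    toCtxVec : ∀ {m n} → Vec (PR n) m → Vec (Ctx n) m
    toCtxVec []       = []
    toCtxVec (g ∷ gs) = toCtx g ∷ toCtxVec gs

  mutual
    fill-toCtx : ∀ {n} (p : PR n) c → fill (toCtx p) c ≡ p
    fill-toCtx Z           c = refl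
    fill-toCtx S           c = refl
    fill-toCtx (P i)       c = refl
    fill-toCtx (comp f gs) c = cong₂ comp (fill-toCtx f c) (fillVec-toCtxVec gs c)
    fill-toCtx (rec g h)   c = cong₂ rec (fill-toCtx g c) (fill-toCtx h c)
    fill-toCtx (mu f)      c = cong mu (fill-toCtx f c)

    fillVec-toCtxVec : ∀ {m n} (gs : Vec (PR n) m) c → fillVec (toCtxVec gs) c ≡ gs
    fillVec-toCtxVec []       c = refl
    fillVec-toCtxVec (g ∷ gs) c = cong₂ _∷_ (fill-toCtx g c) (fillVec-toCtxVec gs c)

  tag args : ∀ {n} → PR n → ℕ
  tag Z          = 0
  tag S          = 1
  tag (P _)      = 2
  tag (comp _ _) = 3
  tag (rec _ _)  = 4
  tag (mu _)     = 5
  args Z           = 0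
  args S           = 0
  args (P i)       = toℕ i
  args (comp f gs) = pair (enc f) (encVec gs)
  args (rec g h)   = pair (enc g) (enc h)
  args (mu f)      = enc f

  raw-tag-args : ∀ {n} (c : PR n) → raw c ≡ pair (tag c) (args c)
  raw-tag-args Z          = refl
  raw-tag-args S          = refl
  raw-tag-args (P _)      = refl
  raw-tag-args (comp _ _) = refl
  raw-tag-args (rec _ _)  = refl
  raw-tag-args (mu _)     = refl

  data Shape : ∀ {n} → ℕ → PR n → Set where
    Z    : ∀ {n} → Shape {n} 0 Z
    S    : Shape 1 S
    P    : ∀ {n} (i : Fin n) → Shape 2 (P i)
    comp : ∀ {m n} (f : PR m) (gs : Vec (PR n) m) → Shape 3 (comp f gs)
    rec  : ∀ {n} (g : PR n) (h : PR (suc (suc n))) → Shape 4 (rec g h)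
    mu   : ∀ {n} (f : PR (suc n)) → Shape 5 (mu f)

  shape : ∀ {n} (c : PR n) → Shape (tag c) c
  shape Z           = Z
  shape S           = S
  shape (P i)       = P i
  shape (comp f gs) = comp f gs
  shape (rec g h)   = rec g h
  shape (mu f)      = mu f

  view : ∀ {n} (c : PR n) k X → raw c ≡ pair k X → Shape k c × args c ≡ X
  view c k X eq = subst (λ k → Shape k c) (cong proj₁ tag-args≡) (shape c) , cong proj₂ tag-args≡
    where
    tag-args≡ : (tag c , args c) ≡ (k , X)
    tag-args≡ = begin
      (tag c , args c)             ≡⟨ unpair-pair (tag c) (args c) ⟨
      unpair (pair (tag c) (args c)) ≡⟨ cong unpair (trans (sym (raw-tag-args c)) eq) ⟩
      unpair (pair k X)            ≡⟨ unpair-pair k X ⟩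
      (k , X)                      ∎
      where open ≡-Reasoning

  mutual
    enc-injective-Σ : ∀ {m m′} (a : PR m) (b : PR m′) → enc a ≡ enc b → _≡_ {A = Σ ℕ PR} (m , a) (m′ , b)
    enc-injective-Σ {m} {m′} a b eq with pair-injectiveˡ {m} {raw a} {m′} {raw b} eq
    ... | refl = cong (m ,_) (raw-injective a b (pair-injectiveʳ {m} {raw a} {m} {raw b} eq))

    raw-injective : ∀ {n} (a b : PR n) → raw a ≡ raw b → a ≡ b
    raw-injective a b eq with view b (tag a) (args a) (trans (sym eq) (raw-tag-args a))
    raw-injective Z           .Z            eq | Z         , _  = refl
    raw-injective S           .S            eq | S         , _  = refl
    raw-injective (P i)       .(P i′)       eq | P i′      , e  = cong P (toℕ-injective (sym e))
    raw-injective (comp f gs) .(comp f′ gs′) eq | comp f′ gs′ , e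
      with enc-injective-Σ f f′ (sym (pair-injectiveˡ {enc f′} {encVec gs′} {enc f} {encVec gs} e))
    ... | refl = cong (comp f) (encVec-injective gs gs′ (sym (pair-injectiveʳ {enc f} {encVec gs′} {enc f} {encVec gs} e)))
    raw-injective (rec g h)   .(rec g′ h′)   eq | rec g′ h′  , e
      with enc-injective-Σ g g′ (sym (pair-injectiveˡ {enc g′} {enc h′} {enc g} {enc h} e))
         | enc-injective-Σ h h′ (sym (pair-injectiveʳ {enc g′} {enc h′} {enc g} {enc h} e))
    ... | refl | refl = refl
    raw-injective (mu f)      .(mu f′)       eq | mu f′      , e with enc-injective-Σ f f′ (sym e)
    ... | refl = refl

    encVec-injective : ∀ {m n} (gs gs′ : Vec (PR n) m) → encVec gs ≡ encVec gs′ → gs ≡ gs′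
    encVec-injective []       []         _  = refl
    encVec-injective (g ∷ gs) (g′ ∷ gs′) eq
      with enc-injective-Σ g g′ (pair-injectiveˡ {enc g} {encVec gs} {enc g′} {encVec gs′} (suc-injective eq))
    ... | refl =
      cong (g ∷_) (encVec-injective gs gs′ (pair-injectiveʳ {enc g} {encVec gs} {enc g} {encVec gs′} (suc-injective eq)))

  enc-injective : ∀ {n} (a b : PR n) → enc a ≡ enc b → a ≡ b
  enc-injective a b eq with enc-injective-Σ a b eq
  ... | refl = refl

  -- Opaque: codes of concrete programs are huge numerals that must never be normalised.
  opaque
    mutual
      encCtx : ∀ {n} → Ctx n → ℕ → ℕ
      encCtx {n} Z           e = pair n (pair 0 0)
      encCtx     S           e = pair 1 (pair 1 0)
      encCtx {n} (P i)       e = pair n (pair 2 (toℕ i))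
      encCtx {n} (comp f gs) e = pair n (pair 3 (pair (encCtx f e) (encCtxVec gs e)))
      encCtx {n} (rec g h)   e = pair n (pair 4 (pair (encCtx g e) (encCtx h e)))
      encCtx {n} (mu f)      e = pair n (pair 5 (encCtx f e))
      encCtx     hole        e = e

      encCtxVec : ∀ {m n} → Vec (Ctx n) m → ℕ → ℕ
      encCtxVec []       e = 0
      encCtxVec (g ∷ gs) e = suc (pair (encCtx g e) (encCtxVec gs e))

    mutual
      enc-fill : ∀ {n} (C : Ctx n) c → enc (fill C c) ≡ encCtx C (enc c)
      enc-fill Z           c = refl
      enc-fill S           c = refl
      enc-fill (P i)       c = refl
      enc-fill {n} (comp f gs) c =
        cong₂ (λ a b → pair n (pair 3 (pair a b))) (enc-fill f c) (encVec-fillVec gs c)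
      enc-fill {n} (rec g h)   c =
        cong₂ (λ a b → pair n (pair 4 (pair a b))) (enc-fill g c) (enc-fill h c)
      enc-fill {n} (mu f)      c = cong (λ a → pair n (pair 5 a)) (enc-fill f c)
      enc-fill hole        c = refl

      encVec-fillVec : ∀ {m n} (gs : Vec (Ctx n) m) c → encVec (fillVec gs c) ≡ encCtxVec gs (enc c)
      encVec-fillVec []       c = refl
      encVec-fillVec (g ∷ gs) c = cong₂ (λ a b → suc (pair a b)) (enc-fill g c) (encVec-fillVec gs c)

  fill-unique : ∀ {n} (C : Ctx n) c (c′ : PR n) → enc c′ ≡ encCtx C (enc c) → c′ ≡ fill C c
  fill-unique C c c′ eq = enc-injective c′ (fill C c) (trans eq (sym (enc-fill C c)))

  mutual
    data HasHole : ∀ {n} → Ctx n → Set where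
      hole  : HasHole hole
      compˡ : ∀ {m n} {f : Ctx m} {gs : Vec (Ctx n) m} → HasHole f → HasHole (comp f gs)
      compʳ : ∀ {m n} {f : Ctx m} {gs : Vec (Ctx n) m} → HasHoleVec gs → HasHole (comp f gs)
      recˡ  : ∀ {n} {g : Ctx n} {h : Ctx (suc (suc n))} → HasHole g → HasHole (rec g h)
      recʳ  : ∀ {n} {g : Ctx n} {h : Ctx (suc (suc n))} → HasHole h → HasHole (rec g h)
      mu    : ∀ {n} {f : Ctx (suc n)} → HasHole f → HasHole (mu f)

    data HasHoleVec : ∀ {m n} → Vec (Ctx n) m → Set where
      here  : ∀ {m n} {g : Ctx n} {gs : Vec (Ctx n) m} → HasHole g → HasHoleVec (g ∷ gs)
      there : ∀ {m n} {g : Ctx n} {gs : Vec (Ctx n) m} → HasHoleVec gs → HasHoleVec (g ∷ gs)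

  enc-shape : ∀ {n} (c : PR n) k Y → enc c ≡ pair n (pair k Y) → Shape k c × args c ≡ Y
  enc-shape {n} c k Y eq = view c k Y (pair-injectiveʳ {n} {raw c} {n} {pair k Y} eq)

  opaque
    unfolding encCtx

    encVec≡encCtxVec⇒length : ∀ {m m′ n} (gs′ : Vec (PR n) m′) (gs : Vec (Ctx n) m) {e} →
                              encVec gs′ ≡ encCtxVec gs e → m′ ≡ m
    encVec≡encCtxVec⇒length []         []       eq = refl
    encVec≡encCtxVec⇒length (g′ ∷ gs′) (g ∷ gs) {e} eq = cong suc (encVec≡encCtxVec⇒length gs′ gs
      (pair-injectiveʳ {enc g′} {encVec gs′} {encCtx g e} {encCtxVec gs e} (suc-injective eq)))

    mutual
      code-of-filler : ∀ {n} {C : Ctx n} → HasHole C → (c′ : PR n) → ∀ {e} →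
                       enc c′ ≡ encCtx C e → Σ (PR 1) λ c → enc c ≡ e
      code-of-filler hole c′ eq = c′ , eq
      code-of-filler (compˡ {f = f} {gs} h) c′ {e} eq
        with enc-shape c′ 3 (pair (encCtx f e) (encCtxVec gs e)) eq
      ... | comp f′ gs′ , eq′
        with encVec≡encCtxVec⇒length gs′ gs (pair-injectiveʳ {enc f′} {encVec gs′} {encCtx f e} {encCtxVec gs e} eq′)
      ... | refl = code-of-filler h f′ (pair-injectiveˡ {enc f′} {encVec gs′} {encCtx f e} {encCtxVec gs e} eq′)
      code-of-filler (compʳ {f = f} {gs} h) c′ {e} eq
        with enc-shape c′ 3 (pair (encCtx f e) (encCtxVec gs e)) eq
      ... | comp f′ gs′ , eq′ =
        code-of-fillerVec h gs′ (pair-injectiveʳ {enc f′} {encVec gs′} {encCtx f e} {encCtxVec gs e} eq′)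
      code-of-filler (recˡ {g = g} {h′} h) c′ {e} eq
        with enc-shape c′ 4 (pair (encCtx g e) (encCtx h′ e)) eq
      ... | rec g′ h″ , eq′ = code-of-filler h g′ (pair-injectiveˡ {enc g′} {enc h″} {encCtx g e} {encCtx h′ e} eq′)
      code-of-filler (recʳ {g = g} {h′} h) c′ {e} eq
        with enc-shape c′ 4 (pair (encCtx g e) (encCtx h′ e)) eq
      ... | rec g′ h″ , eq′ = code-of-filler h h″ (pair-injectiveʳ {enc g′} {enc h″} {encCtx g e} {encCtx h′ e} eq′)
      code-of-filler (mu {f = f} h) c′ {e} eq with enc-shape c′ 5 (encCtx f e) eq
      ... | mu f′ , eq′ = code-of-filler h f′ eq′

      code-of-fillerVec : ∀ {m m′ n} {gs : Vec (Ctx n) m} → HasHoleVec gs → (gs′ : Vec (PR n) m′) → ∀ {e} →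
                          encVec gs′ ≡ encCtxVec gs e → Σ (PR 1) λ c → enc c ≡ e
      code-of-fillerVec (here {g = g} {gs} h) (g′ ∷ gs′) {e} eq =
        code-of-filler h g′ (pair-injectiveˡ {enc g′} {encVec gs′} {encCtx g e} {encCtxVec gs e} (suc-injective eq))
      code-of-fillerVec (there {g = g} {gs} h) (g′ ∷ gs′) {e} eq =
        code-of-fillerVec h gs′ (pair-injectiveʳ {enc g′} {encVec gs′} {encCtx g e} {encCtxVec gs e} (suc-injective eq))

module OraclePrograms where

  open Programs
  open import Data.Nat
  open import Data.Nat.Properties
  open import Data.Fin using (Fin) renaming (zero to fz; suc to fs)
  open import Data.Vec using (Vec; []; _∷_)
  open import Data.Product using (Σ; _,_)
  open import Relation.Binary.PropositionalEquality

  _Computes_ : PR 1 → (ℕ → ℕ) → Set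
  c Computes χ = ∀ x → Eval c (x ∷ []) (χ x)

  record OProg (n : ℕ) : Set where
    constructor oprog
    field
      ctx  : Ctx n
      ⟦_⟧  : (ℕ → ℕ) → Vec ℕ n → ℕ
      eval : ∀ {c χ} → c Computes χ → ∀ xs → Eval (fill ctx c) xs (⟦_⟧ χ xs)
  open OProg public

  ⟦_⟧₁ : OProg 1 → (ℕ → ℕ) → ℕ → ℕ
  ⟦ M ⟧₁ χ x = ⟦ M ⟧ χ (x ∷ [])

  zeroᴼ : ∀ {n} → OProg n
  zeroᴼ = oprog Z (λ _ _ → 0) (λ _ _ → evZ)

  sucᴼ : OProg 1
  sucᴼ = oprog S (λ { _ (x ∷ []) → suc x }) (λ { _ (x ∷ []) → evS })

  projᴼ : ∀ {n} → Fin n → OProg n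
  projᴼ i = oprog (P i) (λ _ xs → lookupV xs i) (λ _ _ → evP i)

  oracleᴼ : OProg 1
  oracleᴼ = oprog hole (λ { χ (x ∷ []) → χ x }) (λ { c⇓ (x ∷ []) → c⇓ x })

  ctxVec : ∀ {m n} → Vec (OProg n) m → Vec (Ctx n) m
  ctxVec []       = []
  ctxVec (g ∷ gs) = ctx g ∷ ctxVec gs

  ⟦_⟧Vec : ∀ {m n} → Vec (OProg n) m → (ℕ → ℕ) → Vec ℕ n → Vec ℕ m
  ⟦ [] ⟧Vec     χ xs = []
  ⟦ g ∷ gs ⟧Vec χ xs = ⟦ g ⟧ χ xs ∷ ⟦ gs ⟧Vec χ xs

  evalVec : ∀ {m n c χ} → c Computes χ → (gs : Vec (OProg n) m) →
            ∀ xs → EvalVec (fillVec (ctxVec gs) c) xs (⟦ gs ⟧Vec χ xs)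
  evalVec c⇓ []       xs = []
  evalVec c⇓ (g ∷ gs) xs = eval g c⇓ xs ∷ evalVec c⇓ gs xs

  compᴼ : ∀ {m n} → OProg m → Vec (OProg n) m → OProg n
  compᴼ f gs = oprog (comp (ctx f) (ctxVec gs)) (λ χ xs → ⟦ f ⟧ χ (⟦ gs ⟧Vec χ xs))
    (λ c⇓ xs → evComp (evalVec c⇓ gs xs) (eval f c⇓ _))

  iterate : ℕ → (ℕ → ℕ → ℕ) → ℕ → ℕ
  iterate z s zero    = z
  iterate z s (suc k) = s k (iterate z s k)

  recᴼ : ∀ {n} → OProg n → OProg (suc (suc n)) → OProg (suc n)
  recᴼ g h = oprog (rec (ctx g) (ctx h))
    (λ { χ (k ∷ xs) → iterate (⟦ g ⟧ χ xs) (λ k r → ⟦ h ⟧ χ (k ∷ r ∷ xs)) k }) evalRec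
    where
    evalRec : ∀ {c χ} → c Computes χ → ∀ xs → Eval (fill (rec (ctx g) (ctx h)) c) xs _
    evalRec c⇓ (zero  ∷ xs) = evRec0 (eval g c⇓ xs)
    evalRec c⇓ (suc k ∷ xs) = evRecS (evalRec c⇓ (k ∷ xs)) (eval h c⇓ _)

  castᴼ : ∀ {n} (p : OProg n) (F : (ℕ → ℕ) → Vec ℕ n → ℕ) → (∀ χ xs → ⟦ p ⟧ χ xs ≡ F χ xs) → OProg n
  castᴼ p F eq = oprog (ctx p) F (λ {c} {χ} c⇓ xs → subst (Eval (fill (ctx p) c) xs) (eq χ xs) (eval p c⇓ xs))

  -- Minimisation, for a search whose result s is known in advance.
  μᴼ : ∀ {n} (f : OProg (suc n)) (s : Vec ℕ n → ℕ) →
       (∀ χ xs → ⟦ f ⟧ χ (s xs ∷ xs) ≡ 0) →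
       (∀ χ xs k → k < s xs → Σ ℕ λ v → ⟦ f ⟧ χ (k ∷ xs) ≡ suc v) → OProg n
  μᴼ f s zero-at-s nonzero-below = oprog (mu (ctx f)) (λ _ xs → s xs)
    (λ c⇓ xs → evMu (search c⇓ xs (s xs) 0 (+-identityʳ (s xs))))
    where
    search : ∀ {c χ} → c Computes χ → ∀ xs d k → d + k ≡ s xs → MuSearch (fill (ctx f) c) xs k (s xs)
    search {c} {χ} c⇓ xs zero k refl =
      found (subst (Eval (fill (ctx f) c) (k ∷ xs)) (zero-at-s χ xs) (eval f c⇓ _))
    search {c} {χ} c⇓ xs (suc d) k eq with nonzero-below χ xs k (subst (k <_) eq (s≤s (m≤n+m k d)))
    ... | v , fk≡1+v = next (subst (Eval (fill (ctx f) c) (k ∷ xs)) fk≡1+v (eval f c⇓ _))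
                            (search c⇓ xs d (suc k) (trans (+-suc d k) eq))

  app₁ : ∀ {n} → OProg 1 → OProg n → OProg n
  app₁ f a = compᴼ f (a ∷ [])

  app₂ : ∀ {n} → OProg 2 → OProg n → OProg n → OProg n
  app₂ f a b = compᴼ f (a ∷ b ∷ [])

  app₃ : ∀ {n} → OProg 3 → OProg n → OProg n → OProg n → OProg n
  app₃ f a b c = compᴼ f (a ∷ b ∷ c ∷ [])

  #0 : ∀ {n} → OProg (suc n)
  #0 = projᴼ fz
  #1 : ∀ {n} → OProg (suc (suc n))
  #1 = projᴼ (fs fz)
  #2 : ∀ {n} → OProg (suc (suc (suc n)))
  #2 = projᴼ (fs (fs fz))

  constᴼ : ∀ {n} → ℕ → OProg n
  constᴼ k = castᴼ (go k) (λ _ _ → k) (go-correct k)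
    where
    go : ∀ {n} → ℕ → OProg n
    go zero    = zeroᴼ
    go (suc k) = app₁ sucᴼ (go k)
    go-correct : ∀ {n} k χ (xs : Vec ℕ n) → ⟦ go k ⟧ χ xs ≡ k
    go-correct zero    χ xs = refl
    go-correct (suc k) χ xs = cong suc (go-correct k χ xs)

module Arithmetic where

  open Coding
  open OraclePrograms
  open import Data.Nat
  open import Data.Nat.Properties
  open import Data.Vec using ([]; _∷_)
  open import Data.Product using (_,_)
  open import Relation.Binary.PropositionalEquality

  -- Truth values are 0 (false) and 1 (true).
  sg isZero : ℕ → ℕ
  sg zero    = 0
  sg (suc _) = 1
  isZero zero    = 1
  isZero (suc _) = 0

  ifPos : ℕ → ℕ → ℕ → ℕ
  ifPos zero    x y = y
  ifPos (suc _) x y = x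

  _⇒ℕ_ : ℕ → ℕ → ℕ
  b ⇒ℕ x = ifPos b x 1

  eqℕ : ℕ → ℕ → ℕ
  eqℕ zero    zero    = 1
  eqℕ zero    (suc _) = 0
  eqℕ (suc _) zero    = 0
  eqℕ (suc a) (suc b) = eqℕ a b

  addᴼ : OProg 2
  addᴼ = castᴼ (recᴼ #0 (app₁ sucᴼ #1)) (λ { _ (k ∷ y ∷ []) → k + y })
    (λ { _ (k ∷ y ∷ []) → correct k y })
    where
    correct : ∀ k y → iterate y (λ _ r → suc r) k ≡ k + y
    correct zero    y = refl
    correct (suc k) y = cong suc (correct k y)

  mulᴼ : OProg 2
  mulᴼ = castᴼ (recᴼ zeroᴼ (app₂ addᴼ #2 #1)) (λ { _ (k ∷ y ∷ []) → k * y })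
    (λ { _ (k ∷ y ∷ []) → correct k y })
    where
    correct : ∀ k y → iterate 0 (λ _ r → y + r) k ≡ k * y
    correct zero    y = refl
    correct (suc k) y = cong (y +_) (correct k y)

  predᴼ : OProg 1
  predᴼ = castᴼ (recᴼ zeroᴼ #0) (λ { _ (k ∷ []) → k ∸ 1 }) (λ { _ (zero ∷ []) → refl ; _ (suc k ∷ []) → refl })

  monusᴼ : OProg 2
  monusᴼ = castᴼ (app₂ (recᴼ #0 (app₁ predᴼ #1)) #1 #0) (λ { _ (x ∷ y ∷ []) → x ∸ y })
    (λ { _ (x ∷ y ∷ []) → correct y x })
    where
    correct : ∀ k y → iterate y (λ _ r → r ∸ 1) k ≡ y ∸ k
    correct zero    y = refl
    correct (suc k) y = begin
      iterate y (λ _ r → r ∸ 1) k ∸ 1 ≡⟨ cong (_∸ 1) (correct k y) ⟩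
      y ∸ k ∸ 1                       ≡⟨ ∸-+-assoc y k 1 ⟩
      y ∸ (k + 1)                     ≡⟨ cong (y ∸_) (+-comm k 1) ⟩
      y ∸ suc k                       ∎
      where open ≡-Reasoning

  sgᴼ : OProg 1
  sgᴼ = castᴼ (recᴼ zeroᴼ (constᴼ 1)) (λ { _ (k ∷ []) → sg k })
    (λ { _ (zero ∷ []) → refl ; _ (suc k ∷ []) → refl })

  isZeroᴼ : OProg 1
  isZeroᴼ = castᴼ (recᴼ (constᴼ 1) zeroᴼ) (λ { _ (k ∷ []) → isZero k })
    (λ { _ (zero ∷ []) → refl ; _ (suc k ∷ []) → refl })

  -- a and b are equal iff the two truncated differences both vanish.
  eqᴼ : OProg 2
  eqᴼ = castᴼ (app₁ isZeroᴼ (app₂ addᴼ (app₂ monusᴼ #0 #1) (app₂ monusᴼ #1 #0)))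
    (λ { _ (a ∷ b ∷ []) → eqℕ a b }) (λ { _ (a ∷ b ∷ []) → correct a b })
    where
    correct : ∀ a b → isZero ((a ∸ b) + (b ∸ a)) ≡ eqℕ a b
    correct zero    zero    = refl
    correct zero    (suc b) = refl
    correct (suc a) zero    = refl
    correct (suc a) (suc b) = correct a b

  ifPosᴼ : OProg 3
  ifPosᴼ = castᴼ (recᴼ #1 #2) (λ { _ (b ∷ x ∷ y ∷ []) → ifPos b x y })
    (λ { _ (zero ∷ x ∷ y ∷ []) → refl ; _ (suc b ∷ x ∷ y ∷ []) → refl })

  triᴼ : OProg 1
  triᴼ = castᴼ (recᴼ zeroᴼ (app₂ addᴼ (app₁ sucᴼ #0) #1)) (λ { _ (k ∷ []) → tri k })
    (λ { _ (k ∷ []) → correct k })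
    where
    correct : ∀ k → iterate 0 (λ k r → suc k + r) k ≡ tri k
    correct zero    = refl
    correct (suc k) = cong (suc k +_) (correct k)

  pairᴼ : OProg 2
  pairᴼ = castᴼ (app₂ addᴼ (app₁ triᴼ (app₂ addᴼ #0 #1)) #1) (λ { _ (a ∷ b ∷ []) → pair a b })
    (λ { _ (a ∷ b ∷ []) → refl })

  -- The diagonal fst w + snd w of w is the least k with w < tri (1 + k).
  diagonalᴼ : OProg 1
  diagonalᴼ = μᴼ (app₂ monusᴼ (app₁ sucᴼ #1) (app₁ triᴼ (app₁ sucᴼ #0))) (λ { (w ∷ []) → fst w + snd w })
    (λ { _ (w ∷ []) → m≤n⇒m∸n≡0 (subst (λ v → suc v ≤ tri (suc (fst w + snd w))) (pair-fst-snd w)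
                                                  (pair<tri[1+a+b] (fst w) (snd w))) })
    (λ { _ (w ∷ []) k k<diag → _ , +-∸-assoc 1 (≤-trans (tri-mono-≤ k<diag)
           (subst (tri (fst w + snd w) ≤_) (pair-fst-snd w) (tri[a+b]≤pair (fst w) (snd w)))) })

  sndᴼ : OProg 1
  sndᴼ = castᴼ (app₂ monusᴼ #0 (app₁ triᴼ (app₁ diagonalᴼ #0))) (λ { _ (w ∷ []) → snd w })
    (λ { _ (w ∷ []) → correct w })
    where
    correct : ∀ w → w ∸ tri (fst w + snd w) ≡ snd w
    correct w = trans (cong (_∸ tri (fst w + snd w)) (sym (pair-fst-snd w))) (m+n∸m≡n (tri (fst w + snd w)) (snd w))

  fstᴼ : OProg 1
  fstᴼ = castᴼ (app₂ monusᴼ (app₁ diagonalᴼ #0) (app₁ sndᴼ #0)) (λ { _ (w ∷ []) → fst w })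
    (λ { _ (w ∷ []) → m+n∸n≡m (fst w) (snd w) })

  consᴼ : OProg 2
  consᴼ = app₁ sucᴼ pairᴼ

  headᴼ tailᴼ : OProg 1
  headᴼ = app₁ fstᴼ predᴼ
  tailᴼ = app₁ sndᴼ predᴼ

  infixl 6 _+ᴼ_
  infixl 7 _*ᴼ_
  infixr 5 _⇒ᴼ_

  _+ᴼ_ _*ᴼ_ _⇒ᴼ_ _≟ᴼ_ : ∀ {n} → OProg n → OProg n → OProg n
  a +ᴼ b = app₂ addᴼ a b
  a *ᴼ b = app₂ mulᴼ a b
  a ⇒ᴼ b = app₃ ifPosᴼ a b (constᴼ 1)
  a ≟ᴼ b = app₂ eqᴼ a b

module Folds where

  open Coding
  open OraclePrograms
  open Arithmetic
  open import Data.Nat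
  open import Data.Nat.Properties
  open import Data.Fin using (Fin; _↑ʳ_) renaming (zero to fz; suc to fs)
  open import Data.Vec using (Vec; []; _∷_; _++_; tabulate)
  open import Data.Vec.Properties using (tabulate-cong)
  open import Data.List using ([]; _∷_; foldl; length)
  open import Relation.Binary.PropositionalEquality

  lastᴼ : ∀ {n} j → Vec (OProg (j + n)) n
  lastᴼ j = tabulate (λ i → projᴼ (j ↑ʳ i))

  ⟦tabulate⟧ : ∀ {n k} (f : Fin n → OProg k) χ xs → ⟦ tabulate f ⟧Vec χ xs ≡ tabulate (λ i → ⟦ f i ⟧ χ xs)
  ⟦tabulate⟧ {zero}  f χ xs = refl
  ⟦tabulate⟧ {suc n} f χ xs = cong (⟦ f fz ⟧ χ xs ∷_) (⟦tabulate⟧ (λ i → f (fs i)) χ xs)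

  lookupV-++ʳ : ∀ {n} j (ys : Vec ℕ j) (ps : Vec ℕ n) i → lookupV (ys ++ ps) (j ↑ʳ i) ≡ lookupV ps i
  lookupV-++ʳ zero    []       ps i = refl
  lookupV-++ʳ (suc j) (y ∷ ys) ps i = lookupV-++ʳ j ys ps i

  tabulate-lookupV : ∀ {n} (ps : Vec ℕ n) → tabulate (lookupV ps) ≡ ps
  tabulate-lookupV []       = refl
  tabulate-lookupV (x ∷ ps) = cong (x ∷_) (tabulate-lookupV ps)

  ⟦lastᴼ⟧ : ∀ {n} j (ys : Vec ℕ j) (ps : Vec ℕ n) χ → ⟦ lastᴼ j ⟧Vec χ (ys ++ ps) ≡ ps
  ⟦lastᴼ⟧ j ys ps χ = trans (⟦tabulate⟧ (λ i → projᴼ (j ↑ʳ i)) χ (ys ++ ps))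
                            (trans (tabulate-cong (lookupV-++ʳ j ys ps)) (tabulate-lookupV ps))

  -- The loop state is (code of the unprocessed suffix , accumulator); a list is no longer than its
  -- code w, so w rounds suffice, and the empty suffix is a fixpoint.
  module _ {n} (init : OProg n) (step : OProg (suc (suc n))) where

    private
      rest : OProg (suc (suc (suc n)))
      rest = app₁ fstᴼ #1

      loopStep : OProg (suc (suc (suc n)))
      loopStep = app₃ ifPosᴼ rest
        (app₂ pairᴼ (app₁ tailᴼ rest) (compᴼ step (app₁ sndᴼ #1 ∷ app₁ headᴼ rest ∷ lastᴼ 3)))
        #1

      loop : OProg (suc (suc n))
      loop = recᴼ (app₂ pairᴼ #0 (compᴼ init (lastᴼ 1))) loopStep

      foldCode : OProg (suc n)
      foldCode = app₁ sndᴼ (compᴼ loop (#0 ∷ #0 ∷ lastᴼ 1))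

    module _ (χ : ℕ → ℕ) (ps : Vec ℕ n) where

      private
        stepF : ℕ → ℕ → ℕ
        stepF acc a = ⟦ step ⟧ χ (acc ∷ a ∷ ps)

        advance : ℕ → ℕ
        advance st = ifPos (fst st) (pair (snd (fst st ∸ 1)) (stepF (snd st) (fst (fst st ∸ 1)))) st

        ⟦loopStep⟧ : ∀ k r w → ⟦ loopStep ⟧ χ (k ∷ r ∷ w ∷ ps) ≡ advance r
        ⟦loopStep⟧ k r w =
          cong (λ v → ifPos (fst r) (pair (snd (fst r ∸ 1)) (⟦ step ⟧ χ (snd r ∷ fst (fst r ∸ 1) ∷ v))) r)
               (⟦lastᴼ⟧ 3 (k ∷ r ∷ w ∷ []) ps χ)

        run : ℕ → ℕ → ℕ
        run k st = iterate st (λ _ → advance) k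

        run-suc : ∀ k st → run (suc k) st ≡ run k (advance st)
        run-suc zero    st = refl
        run-suc (suc k) st = cong advance (run-suc k st)

        run-empty : ∀ k acc → run k (pair 0 acc) ≡ pair 0 acc
        run-empty zero    acc = refl
        run-empty (suc k) acc = trans (cong advance (run-empty k acc)) (fixpoint (fst (pair 0 acc)) (fst-pair 0 acc))
          where
          fixpoint : ∀ r → r ≡ 0 → ∀ {x} → ifPos r x (pair 0 acc) ≡ pair 0 acc
          fixpoint .0 refl = refl

        advance-cons : ∀ r acc → advance (pair (suc r) acc) ≡ pair (snd r) (stepF acc (fst r))
        advance-cons r acc rewrite fst-pair (suc r) acc | snd-pair (suc r) acc = refl

        run-fold : ∀ k r acc → length (decode r) ≤ k → run k (pair r acc) ≡ pair 0 (foldl stepF acc (decode r))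
        run-fold k       zero    acc _ = run-empty k acc
        run-fold (suc k) (suc r) acc (s≤s len≤k) = begin
          run (suc k) (pair (suc r) acc)
            ≡⟨ run-suc k _ ⟩
          run k (advance (pair (suc r) acc))
            ≡⟨ cong (run k) (advance-cons r acc) ⟩
          run k (pair (snd r) (stepF acc (fst r)))
            ≡⟨ run-fold k (snd r) _ (subst (λ l → length l ≤ k) tail≡ len≤k) ⟩
          pair 0 (foldl stepF (stepF acc (fst r)) (decode (snd r)))
            ≡⟨ cong (λ l → pair 0 (foldl stepF (stepF acc (fst r)) l)) tail≡ ⟨
          pair 0 (foldl stepF acc (decode (suc r)))
            ∎
          where
          open ≡-Reasoning
          tail≡ : decodeWithin r (snd r) ≡ decode (snd r)
          tail≡ = decodeWithin-decode r (snd r) (snd≤ r)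

        ⟦loop⟧ : ∀ k w → ⟦ loop ⟧ χ (k ∷ w ∷ ps) ≡ run k (pair w (⟦ init ⟧ χ ps))
        ⟦loop⟧ zero    w = cong (λ v → pair w (⟦ init ⟧ χ v)) (⟦lastᴼ⟧ 1 (w ∷ []) ps χ)
        ⟦loop⟧ (suc k) w = trans (⟦loopStep⟧ k (⟦ loop ⟧ χ (k ∷ w ∷ ps)) w) (cong advance (⟦loop⟧ k w))

      ⟦foldCode⟧ : ∀ w → ⟦ foldCode ⟧ χ (w ∷ ps) ≡ foldl stepF (⟦ init ⟧ χ ps) (decode w)
      ⟦foldCode⟧ w = begin
        snd (⟦ loop ⟧ χ (w ∷ w ∷ ⟦ lastᴼ 1 ⟧Vec χ (w ∷ ps)))
          ≡⟨ cong (λ v → snd (⟦ loop ⟧ χ (w ∷ w ∷ v))) (⟦lastᴼ⟧ 1 (w ∷ []) ps χ) ⟩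
        snd (⟦ loop ⟧ χ (w ∷ w ∷ ps))
          ≡⟨ cong snd (⟦loop⟧ w w) ⟩
        snd (run w (pair w (⟦ init ⟧ χ ps)))
          ≡⟨ cong snd (run-fold w w (⟦ init ⟧ χ ps) (length-decode≤ w)) ⟩
        snd (pair 0 (foldl stepF (⟦ init ⟧ χ ps) (decode w)))
          ≡⟨ snd-pair 0 _ ⟩
        foldl stepF (⟦ init ⟧ χ ps) (decode w)
          ∎
        where open ≡-Reasoning

    foldlᴼ : OProg (suc n)
    foldlᴼ = castᴼ foldCode
      (λ { χ (w ∷ ps) → foldl (λ acc a → ⟦ step ⟧ χ (acc ∷ a ∷ ps)) (⟦ init ⟧ χ ps) (decode w) })
      (λ { χ (w ∷ ps) → ⟦foldCode⟧ χ ps w })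

module TruthValues where

  open Arithmetic using (sg; isZero; eqℕ; _⇒ℕ_)
  open import Data.Nat
  open import Data.Nat.Properties
  open import Data.Product using (Σ; _×_; _,_; proj₁; proj₂)
  open import Data.Sum using (_⊎_; inj₁; inj₂)
  open import Relation.Binary.PropositionalEquality

  Binary : (ℕ → ℕ) → Set
  Binary χ = ∀ x → χ x ≤ 1

  binary-cases : ∀ {a} → a ≤ 1 → a ≡ 0 ⊎ a ≡ 1
  binary-cases z≤n       = inj₁ refl
  binary-cases (s≤s z≤n) = inj₂ refl

  *≡1⇒ : ∀ m n → m * n ≡ 1 → m ≡ 1 × n ≡ 1
  *≡1⇒ m n eq = m*n≡1⇒m≡1 m n eq , m*n≡1⇒n≡1 m n eq

  *-binary : ∀ {m n} → m ≤ 1 → n ≤ 1 → m * n ≤ 1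
  *-binary = *-mono-≤

  eqℕ≡1⇒≡ : ∀ a b → eqℕ a b ≡ 1 → a ≡ b
  eqℕ≡1⇒≡ zero    zero    _  = refl
  eqℕ≡1⇒≡ (suc a) (suc b) eq = cong suc (eqℕ≡1⇒≡ a b eq)

  ≡⇒eqℕ≡1 : ∀ {a b} → a ≡ b → eqℕ a b ≡ 1
  ≡⇒eqℕ≡1 {zero}  refl = refl
  ≡⇒eqℕ≡1 {suc a} refl = ≡⇒eqℕ≡1 {a} refl

  eqℕ-binary : ∀ a b → eqℕ a b ≤ 1
  eqℕ-binary zero    zero    = s≤s z≤n
  eqℕ-binary zero    (suc b) = z≤n
  eqℕ-binary (suc a) zero    = z≤n
  eqℕ-binary (suc a) (suc b) = eqℕ-binary a b

  isZero-binary : ∀ a → isZero a ≤ 1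
  isZero-binary zero    = s≤s z≤n
  isZero-binary (suc a) = z≤n

  isZero≡1⇒≡0 : ∀ a → isZero a ≡ 1 → a ≡ 0
  isZero≡1⇒≡0 zero _ = refl

  sg-binary : ∀ a → sg a ≤ 1
  sg-binary zero    = z≤n
  sg-binary (suc a) = s≤s z≤n

  sg≡1⇒>0 : ∀ a → sg a ≡ 1 → 0 < a
  sg≡1⇒>0 (suc a) _ = s≤s z≤n

  >0⇒sg≡1 : ∀ {a} → 0 < a → sg a ≡ 1
  >0⇒sg≡1 (s≤s _) = refl

  ⇒ℕ-binary : ∀ b {x} → x ≤ 1 → b ⇒ℕ x ≤ 1
  ⇒ℕ-binary zero    _   = s≤s z≤n
  ⇒ℕ-binary (suc b) x≤1 = x≤1

  ⇒ℕ≡1⇒ : ∀ b {x} → b ⇒ℕ x ≡ 1 → b ≡ 1 → x ≡ 1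
  ⇒ℕ≡1⇒ (suc zero) eq refl = eq

  pos-⇒ℕ : ∀ {b x} → 0 < b → b ⇒ℕ x ≡ x
  pos-⇒ℕ (s≤s _) = refl

  ⇒ℕ≡1⇐ : ∀ {b x} → b ≤ 1 → (b ≡ 1 → x ≡ 1) → b ⇒ℕ x ≡ 1
  ⇒ℕ≡1⇐ z≤n       _ = refl
  ⇒ℕ≡1⇐ (s≤s z≤n) f = f refl

  ∏< ∑< : (ℕ → ℕ) → ℕ → ℕ
  ∏< h zero    = 1
  ∏< h (suc n) = ∏< h n * h n
  ∑< h zero    = 0
  ∑< h (suc n) = ∑< h n + h n

  ∏<-binary : ∀ {h} → (∀ j → h j ≤ 1) → ∀ n → ∏< h n ≤ 1
  ∏<-binary h01 zero    = s≤s z≤n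
  ∏<-binary h01 (suc n) = *-binary (∏<-binary h01 n) (h01 n)

  ∏<≡1⇒ : ∀ h n → ∏< h n ≡ 1 → ∀ j → j < n → h j ≡ 1
  ∏<≡1⇒ h (suc n) eq j (s≤s j≤n) with m≤n⇒m<n∨m≡n j≤n
  ... | inj₁ j<n  = ∏<≡1⇒ h n (proj₁ (*≡1⇒ (∏< h n) (h n) eq)) j j<n
  ... | inj₂ refl = proj₂ (*≡1⇒ (∏< h n) (h n) eq)

  ∏<≡1⇐ : ∀ {h} n → (∀ j → j < n → h j ≡ 1) → ∏< h n ≡ 1
  ∏<≡1⇐ zero    _   = refl
  ∏<≡1⇐ (suc n) all = cong₂ _*_ (∏<≡1⇐ n (λ j j<n → all j (m≤n⇒m≤1+n j<n))) (all n ≤-refl)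

  ∑<>0⇒ : ∀ {h} n → 0 < ∑< h n → Σ ℕ λ j → j < n × 0 < h j
  ∑<>0⇒ {h} (suc n) pos with h n in hn≡
  ... | suc _ = n , ≤-refl , subst (0 <_) (sym hn≡) (s≤s z≤n)
  ... | zero with ∑<>0⇒ n (subst (0 <_) (+-identityʳ (∑< h n)) pos)
  ...   | j , j<n , hj>0 = j , m≤n⇒m≤1+n j<n , hj>0

  ∑<>0⇐ : ∀ {h} n j → j < n → 0 < h j → 0 < ∑< h n
  ∑<>0⇐ {h} (suc n) j (s≤s j≤n) hj>0 with m≤n⇒m<n∨m≡n j≤n
  ... | inj₁ j<n  = ≤-trans (∑<>0⇐ n j j<n hj>0) (m≤m+n (∑< h n) (h n))
  ... | inj₂ refl = ≤-trans hj>0 (m≤n+m (h j) (∑< h j))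

module Reductions where

  open import Level using (0ℓ)
  open Programs
  open OraclePrograms
  open Arithmetic
  open TruthValues
  open import Data.Nat
  open import Data.Nat.Properties
  open import Data.Fin using (toℕ) renaming (zero to fz; suc to fs)
  open import Data.Vec using (Vec; []; _∷_)
  open import Data.Product using (Σ; _×_; _,_; proj₁; proj₂)
  open import Data.Sum using (inj₁; inj₂)
  open import Relation.Unary using (Pred; _≐_)
  open import Relation.Unary.Properties using (≐-sym)
  open import Relation.Binary.PropositionalEquality

  Ones : (ℕ → ℕ) → Pred ℕ 0ℓ
  Ones χ x = χ x ≡ 1

  record CharIndex (e : ℕ) : Set where
    constructor charIndex
    field
      {prog}   : PR 1
      {χ}      : ℕ → ℕ
      computes : prog Computes χ
      binary   : Binary χ
      code     : enc prog ≡ e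

  module _ {e} (ι : CharIndex e) where
    open CharIndex ι

    Φ-unique : ∀ {x y} → Φ e x y → y ≡ χ x
    Φ-unique (c′ , c′≡e , ev) with enc-injective c′ prog (trans c′≡e (sym code))
    ... | refl = Eval-deterministic ev (computes _)

    Φ-χ : ∀ x → Φ e x (χ x)
    Φ-χ x = prog , code , computes x

    Set[]≐Ones : Set[ e ] ≐ Ones χ
    Set[]≐Ones = (λ s → sym (Φ-unique s)) , (λ χx≡1 → subst (Φ e _) χx≡1 (Φ-χ _))

    CharIndex⇒IsCharFn : IsCharFn e
    CharIndex⇒IsCharFn x with binary-cases (binary x)
    ... | inj₁ χx≡0 = inj₁ (subst (Φ e x) χx≡0 (Φ-χ x))
    ... | inj₂ χx≡1 = inj₂ (subst (Φ e x) χx≡1 (Φ-χ x))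

  IsCharFn⇒CharIndex : ∀ {e} → IsCharFn e → CharIndex e
  IsCharFn⇒CharIndex {e} isChar = charIndex computes (λ x → proj₁ (proj₂ (value x))) (code 0)
    where
    Value : ℕ → Set
    Value x = Σ ℕ λ v → v ≤ 1 × Σ (PR 1) λ c → enc c ≡ e × Eval c (x ∷ []) v
    value : ∀ x → Value x
    value x with isChar x
    ... | inj₁ (c , c≡e , ev) = 0 , z≤n , c , c≡e , ev
    ... | inj₂ (c , c≡e , ev) = 1 , s≤s z≤n , c , c≡e , ev
    progAt : ℕ → PR 1
    progAt x = proj₁ (proj₂ (proj₂ (value x)))
    code : ∀ x → enc (progAt x) ≡ e
    code x = proj₁ (proj₂ (proj₂ (proj₂ (value x))))
    computes : progAt 0 Computes (λ x → proj₁ (value x))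
    computes x = subst (λ c → Eval c (x ∷ []) (proj₁ (value x))) (enc-injective _ _ (trans (code x) (sym (code 0))))
                       (proj₂ (proj₂ (proj₂ (proj₂ (value x)))))

  closed : ∀ {n} → OProg n → PR n
  closed p = fill (ctx p) Z

  eval-closed : ∀ {n} (p : OProg n) xs → Eval (closed p) xs (⟦ p ⟧ (λ _ → 0) xs)
  eval-closed p = eval p (λ _ → evZ)

  eval-toCtx : ∀ {n} (p : PR n) c {xs y} → Eval p xs y → Eval (fill (toCtx p) c) xs y
  eval-toCtx p c {xs} {y} = subst (λ q → Eval q xs y) (sym (fill-toCtx p c))

  eval-toCtx⁻ : ∀ {n} (p : PR n) c {xs y} → Eval (fill (toCtx p) c) xs y → Eval p xs y
  eval-toCtx⁻ p c {xs} {y} = subst (λ q → Eval q xs y) (fill-toCtx p c)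

  addPR : PR 2
  addPR = closed addᴼ

  -- μ z. v ∸ 1, which halts (at once, with value 0) iff v ≤ 1.
  validator : PR 1
  validator = mu (closed (app₂ monusᴼ #1 (constᴼ 1)))

  validator-accepts : ∀ {v} → v ≤ 1 → Eval validator (v ∷ []) 0
  validator-accepts {v} v≤1 =
    evMu (found (subst (Eval _ (0 ∷ v ∷ [])) (m≤n⇒m∸n≡0 v≤1) (eval-closed (app₂ monusᴼ #1 (constᴼ 1)) _)))

  validator-binary : ∀ {v y} → Eval validator (v ∷ []) y → v ≤ 1
  validator-binary (evMu search) = go search
    where
    go : ∀ {v k y} → MuSearch (closed (app₂ monusᴼ #1 (constᴼ 1))) (v ∷ []) k y → v ≤ 1
    go {v} {k} (found v∸1≡0) =
      m∸n≡0⇒m≤n (sym (Eval-deterministic v∸1≡0 (eval-closed (app₂ monusᴼ #1 (constᴼ 1)) (k ∷ v ∷ []))))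
    go (next _ search) = go search

  -- x ↦ Σ_{w<x} validator (c w), for the program c plugged into the hole.
  binaryBelow : Ctx 1
  binaryBelow = rec Z (comp (toCtx addPR) (P (fs fz) ∷ comp (toCtx validator) (comp hole (P fz ∷ []) ∷ []) ∷ []))

  binaryBelow-accepts : ∀ {c χ} → c Computes χ → Binary χ → ∀ x → Eval (fill binaryBelow c) (x ∷ []) 0
  binaryBelow-accepts c⇓ χ01 zero    = evRec0 evZ
  binaryBelow-accepts {c} c⇓ χ01 (suc x) = evRecS (binaryBelow-accepts c⇓ χ01 x)
    (evComp (evP (fs fz) ∷ evComp (evComp (evP fz ∷ []) (c⇓ x) ∷ [])
                                   (eval-toCtx validator c (validator-accepts (χ01 x))) ∷ [])
            (eval-toCtx addPR c (eval-closed addᴼ (0 ∷ 0 ∷ []))))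

  binaryBelow-binary : ∀ {c x y} → Eval (fill binaryBelow c) (x ∷ []) y →
                       ∀ w → w < x → Σ ℕ λ v → Eval c (w ∷ []) v × v ≤ 1
  binaryBelow-binary {c} {suc x} (evRecS below (evComp (_ ∷ evComp (evComp (evP _ ∷ []) cx ∷ []) valid ∷ []) _)) w (s≤s w≤x)
    with m≤n⇒m<n∨m≡n w≤x
  ... | inj₁ w<x  = binaryBelow-binary below w w<x
  ... | inj₂ refl = _ , cx , validator-binary (eval-toCtx⁻ validator c valid)

  -- Adding binaryBelow makes the plugged program total and 0/1-valued wherever the result is defined,
  -- so the reduction also reflects being the index of a characteristic function.
  guarded : Ctx 1 → Ctx 1
  guarded C = comp (toCtx addPR) (C ∷ binaryBelow ∷ [])

  guarded-hole : ∀ C → HasHole (guarded C)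
  guarded-hole C = compʳ (there (here (recʳ (compʳ (there (here (compʳ (here (compˡ hole)))))))))

  eval-guarded : ∀ (M : OProg 1) {c χ} → c Computes χ → Binary χ → fill (guarded (ctx M)) c Computes ⟦ M ⟧₁ χ
  eval-guarded M {c} c⇓ χ01 x = evComp (eval M c⇓ (x ∷ []) ∷ binaryBelow-accepts c⇓ χ01 x ∷ [])
    (eval-toCtx addPR c (subst (Eval addPR _) (+-identityʳ _) (eval-closed addᴼ (⟦ M ⟧₁ _ x ∷ 0 ∷ []))))

  guarded-binary : ∀ C {c x y} → Eval (fill (guarded C) c) (x ∷ []) y →
                   ∀ w → w < x → Σ ℕ λ v → Eval c (w ∷ []) v × v ≤ 1
  guarded-binary C (evComp (_ ∷ below ∷ []) _) = binaryBelow-binary below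

  private
    tagged : ℕ → ℕ → OProg 1 → OProg 1
    tagged n k p = app₂ pairᴼ (constᴼ n) (app₂ pairᴼ (constᴼ k) p)

  mutual
    encCtxᴼ : ∀ {n} → Ctx n → OProg 1
    encCtxᴼ {n} Z           = tagged n 0 (constᴼ 0)
    encCtxᴼ     S           = tagged 1 1 (constᴼ 0)
    encCtxᴼ {n} (P i)       = tagged n 2 (constᴼ (toℕ i))
    encCtxᴼ {n} (comp f gs) = tagged n 3 (app₂ pairᴼ (encCtxᴼ f) (encCtxVecᴼ gs))
    encCtxᴼ {n} (rec g h)   = tagged n 4 (app₂ pairᴼ (encCtxᴼ g) (encCtxᴼ h))
    encCtxᴼ {n} (mu f)      = tagged n 5 (encCtxᴼ f)
    encCtxᴼ     hole        = #0

    encCtxVecᴼ : ∀ {m n} → Vec (Ctx n) m → OProg 1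
    encCtxVecᴼ []       = constᴼ 0
    encCtxVecᴼ (g ∷ gs) = app₁ sucᴼ (app₂ pairᴼ (encCtxᴼ g) (encCtxVecᴼ gs))

  opaque
    unfolding encCtx

    mutual
      ⟦encCtxᴼ⟧ : ∀ {n} (C : Ctx n) χ e → ⟦ encCtxᴼ C ⟧₁ χ e ≡ encCtx C e
      ⟦encCtxᴼ⟧ Z           χ e = refl
      ⟦encCtxᴼ⟧ S           χ e = refl
      ⟦encCtxᴼ⟧ (P i)       χ e = refl
      ⟦encCtxᴼ⟧ {n} (comp f gs) χ e =
        cong₂ (λ a b → pair n (pair 3 (pair a b))) (⟦encCtxᴼ⟧ f χ e) (⟦encCtxVecᴼ⟧ gs χ e)
      ⟦encCtxᴼ⟧ {n} (rec g h)   χ e =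
        cong₂ (λ a b → pair n (pair 4 (pair a b))) (⟦encCtxᴼ⟧ g χ e) (⟦encCtxᴼ⟧ h χ e)
      ⟦encCtxᴼ⟧ {n} (mu f)      χ e = cong (λ a → pair n (pair 5 a)) (⟦encCtxᴼ⟧ f χ e)
      ⟦encCtxᴼ⟧ hole        χ e = refl

      ⟦encCtxVecᴼ⟧ : ∀ {m n} (gs : Vec (Ctx n) m) χ e → ⟦ encCtxVecᴼ gs ⟧₁ χ e ≡ encCtxVec gs e
      ⟦encCtxVecᴼ⟧ []       χ e = refl
      ⟦encCtxVecᴼ⟧ (g ∷ gs) χ e = cong₂ (λ a b → suc (pair a b)) (⟦encCtxᴼ⟧ g χ e) (⟦encCtxVecᴼ⟧ gs χ e)

  encCtx-computable : (C : Ctx 1) → Computable (encCtx C)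
  encCtx-computable C = closed (encCtxᴼ C) ,
    λ e → subst (Eval _ (e ∷ [])) (⟦encCtxᴼ⟧ C (λ _ → 0) e) (eval-closed (encCtxᴼ C) (e ∷ []))

  CharSet : ∀ {ℓ} → (Pred ℕ 0ℓ → Set ℓ) → Pred ℕ ℓ
  CharSet 𝒫 e = IsCharFn e × 𝒫 Set[ e ]

  Extensional : ∀ {ℓ} → (Pred ℕ 0ℓ → Set ℓ) → Set _
  Extensional 𝒫 = ∀ {S S′} → S ≐ S′ → 𝒫 S → 𝒫 S′

  module _ (M : OProg 1) where

    reduction : ℕ → ℕ
    reduction = encCtx (guarded (ctx M))

    reduction-computable : Computable reduction
    reduction-computable = encCtx-computable (guarded (ctx M))

    reduction-preserves : (∀ χ → Binary χ → Binary (⟦ M ⟧₁ χ)) → ∀ {e} → CharIndex e → CharIndex (reduction e)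
    reduction-preserves M-binary ι = charIndex (eval-guarded M computes binary) (M-binary χ binary)
                                               (trans (enc-fill (guarded (ctx M)) prog) (cong reduction code))
      where open CharIndex ι

    reduction-reflects : ∀ {e} → IsCharFn (reduction e) → CharIndex e
    reduction-reflects {e} isChar = charIndex (λ w → proj₁ (proj₂ (value w))) (λ w → proj₂ (proj₂ (value w))) c≡e
      where
      open CharIndex (IsCharFn⇒CharIndex isChar) renaming (prog to p; computes to p⇓; code to p≡)
      filler : Σ (PR 1) λ c → enc c ≡ e
      filler = code-of-filler (guarded-hole (ctx M)) p p≡
      c : PR 1
      c = proj₁ filler
      c≡e : enc c ≡ e
      c≡e = proj₂ filler
      p≡fill : p ≡ fill (guarded (ctx M)) c
      p≡fill = fill-unique (guarded (ctx M)) c p (trans p≡ (cong reduction (sym c≡e)))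
      value : ∀ w → Σ ℕ λ v → Eval c (w ∷ []) v × v ≤ 1
      value w = guarded-binary (ctx M) (subst (λ q → Eval q (suc w ∷ []) (χ (suc w))) p≡fill (p⇓ (suc w))) w (n<1+n w)

  module _ {ℓ₁ ℓ₂} {𝒫 : Pred ℕ 0ℓ → Set ℓ₁} {𝒬 : Pred ℕ 0ℓ → Set ℓ₂}
           (𝒫-ext : Extensional 𝒫) (𝒬-ext : Extensional 𝒬)
           (M : OProg 1) (M-binary : ∀ χ → Binary χ → Binary (⟦ M ⟧₁ χ))
           (preserve : ∀ χ → Binary χ → 𝒫 (Ones χ) → 𝒬 (Ones (⟦ M ⟧₁ χ)))
           (reflect  : ∀ χ → Binary χ → 𝒬 (Ones (⟦ M ⟧₁ χ)) → 𝒫 (Ones χ)) where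

    CharSet-≤m : CharSet 𝒫 ≤m CharSet 𝒬
    CharSet-≤m = reduction M , reduction-computable M , λ e → forward , backward
      where
      forward : ∀ {e} → CharSet 𝒫 e → CharSet 𝒬 (reduction M e)
      forward {e} (isChar , 𝒫e) = CharIndex⇒IsCharFn ι′ ,
        𝒬-ext (≐-sym (Set[]≐Ones ι′)) (preserve χ binary (𝒫-ext (Set[]≐Ones ι) 𝒫e))
        where
        ι : CharIndex e
        ι = IsCharFn⇒CharIndex isChar
        ι′ : CharIndex (reduction M e)
        ι′ = reduction-preserves M M-binary ι
        open CharIndex ι
      backward : ∀ {e} → CharSet 𝒬 (reduction M e) → CharSet 𝒫 e
      backward {e} (isChar , 𝒬e) = CharIndex⇒IsCharFn ι ,
        𝒫-ext (≐-sym (Set[]≐Ones ι)) (reflect χ binary (𝒬-ext (Set[]≐Ones (reduction-preserves M M-binary ι)) 𝒬e))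
        where
        ι : CharIndex e
        ι = reduction-reflects M isChar
        open CharIndex ι

module BranchTiles where

  open Coding
  open OraclePrograms
  open Arithmetic
  open Folds
  open TruthValues
  open Reductions using (Ones)
  open import Data.Nat
  open import Data.Nat.Properties
  open import Data.Vec using ([]; _∷_)
  open import Data.List using ([]; _∷_; _++_; _∷ʳ_; _ʳ++_; reverse; drop; foldl; initLast; _∷ʳ′_)
  open import Data.List.Properties using (unfold-reverse; reverse-involutive; reverse-++; ++-identityʳ; ++-assoc)
  open import Data.Product using (_×_; _,_; proj₁; proj₂)
  open import Function using (_∘_)
  open import Level using (0ℓ)
  open import Relation.Unary using (Pred)
  open import Relation.Binary.PropositionalEquality

  TreeWithPath : Pred ℕ 0ℓ → Set
  TreeWithPath T = IsTree T × HasInfinitePath T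

  snoc : ℕ → ℕ → ℕ
  snoc w a = ⌜ decode w ∷ʳ a ⌝

  dropLast : ℕ → ℕ
  dropLast w = ⌜ reverse (drop 1 (reverse (decode w))) ⌝

  snoc-⌜⌝ : ∀ σ a → snoc ⌜ σ ⌝ a ≡ ⌜ σ ∷ʳ a ⌝
  snoc-⌜⌝ σ a = cong (λ τ → ⌜ τ ∷ʳ a ⌝) (decode-⌜⌝ σ)

  dropLast-∷ʳ : ∀ σ a → dropLast ⌜ σ ∷ʳ a ⌝ ≡ ⌜ σ ⌝
  dropLast-∷ʳ σ a = cong ⌜_⌝ (begin
    reverse (drop 1 (reverse (decode ⌜ σ ∷ʳ a ⌝))) ≡⟨ cong (reverse ∘ drop 1 ∘ reverse) (decode-⌜⌝ (σ ∷ʳ a)) ⟩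
    reverse (drop 1 (reverse (σ ∷ʳ a)))            ≡⟨ cong (reverse ∘ drop 1) (reverse-++ σ (a ∷ [])) ⟩
    reverse (reverse σ)                            ≡⟨ reverse-involutive σ ⟩
    σ                                              ∎)
    where open ≡-Reasoning

  reverseᴼ : OProg 1
  reverseᴼ = castᴼ (foldlᴼ zeroᴼ (app₂ consᴼ #1 #0)) (λ { _ (w ∷ []) → ⌜ reverse (decode w) ⌝ })
    (λ { _ (w ∷ []) → foldl-cons (decode w) [] })
    where
    foldl-cons : ∀ σ τ → foldl (λ acc a → suc (pair a acc)) ⌜ τ ⌝ σ ≡ ⌜ σ ʳ++ τ ⌝
    foldl-cons []      τ = refl
    foldl-cons (a ∷ σ) τ = foldl-cons σ (a ∷ τ)

  snocᴼ : OProg 2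
  snocᴼ = castᴼ (app₁ reverseᴼ (app₂ consᴼ #1 (app₁ reverseᴼ #0))) (λ { _ (w ∷ a ∷ []) → snoc w a })
    (λ { _ (w ∷ a ∷ []) → cong ⌜_⌝ (correct (decode w) a) })
    where
    correct : ∀ σ a → reverse (decode ⌜ a ∷ reverse σ ⌝) ≡ σ ∷ʳ a
    correct σ a = begin
      reverse (decode ⌜ a ∷ reverse σ ⌝) ≡⟨ cong reverse (decode-⌜⌝ (a ∷ reverse σ)) ⟩
      reverse (a ∷ reverse σ)            ≡⟨ unfold-reverse a (reverse σ) ⟩
      reverse (reverse σ) ∷ʳ a           ≡⟨ cong (_∷ʳ a) (reverse-involutive σ) ⟩
      σ ∷ʳ a                             ∎
      where open ≡-Reasoning

  dropLastᴼ : OProg 1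
  dropLastᴼ = castᴼ (app₁ reverseᴼ (app₁ tailᴼ (app₁ reverseᴼ #0))) (λ { _ (w ∷ []) → dropLast w })
    (λ { _ (w ∷ []) → trans (cong (λ v → ⌜ reverse (decode v) ⌝) (tail-⌜⌝ (reverse (decode w))))
                            (cong (⌜_⌝ ∘ reverse) (decode-⌜⌝ (drop 1 (reverse (decode w))))) })
    where
    tail-⌜⌝ : ∀ σ → snd (⌜ σ ⌝ ∸ 1) ≡ ⌜ drop 1 σ ⌝
    tail-⌜⌝ []      = refl
    tail-⌜⌝ (a ∷ σ) = snd-pair a ⌜ σ ⌝

  module _ {χ : ℕ → ℕ} where

    DropLastClosed : Set
    DropLastClosed = ∀ w → χ w ≡ 1 → χ (dropLast w) ≡ 1

    IsTree⇒DropLastClosed : IsTree (Ones χ) → DropLastClosed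
    IsTree⇒DropLastClosed tree w χw≡1 =
      subst (λ v → χ (dropLast v) ≡ 1) (⌜decode⌝ w)
            (on-codes (decode w) (subst (λ v → χ v ≡ 1) (sym (⌜decode⌝ w)) χw≡1))
      where
      on-codes : ∀ σ → χ ⌜ σ ⌝ ≡ 1 → χ (dropLast ⌜ σ ⌝) ≡ 1
      on-codes σ χσ≡1 with initLast σ
      ... | []       = χσ≡1
      ... | σ′ ∷ʳ′ a = subst (λ v → χ v ≡ 1) (sym (dropLast-∷ʳ σ′ a)) (tree σ′ (a ∷ []) χσ≡1)

    DropLastClosed⇒IsTree : DropLastClosed → IsTree (Ones χ)
    DropLastClosed⇒IsTree closed σ τ χστ≡1 =
      go (reverse τ) (subst (λ ρ → χ ⌜ σ ++ ρ ⌝ ≡ 1) (sym (reverse-involutive τ)) χστ≡1)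
      where
      go : ∀ ρ → χ ⌜ σ ++ reverse ρ ⌝ ≡ 1 → χ ⌜ σ ⌝ ≡ 1
      go []      h = subst (λ τ → χ ⌜ τ ⌝ ≡ 1) (++-identityʳ σ) h
      go (a ∷ ρ) h = go ρ (subst (λ v → χ v ≡ 1) (dropLast-∷ʳ (σ ++ reverse ρ) a) (closed _ h′))
        where
        h′ : χ ⌜ (σ ++ reverse ρ) ∷ʳ a ⌝ ≡ 1
        h′ = subst (λ τ → χ ⌜ τ ⌝ ≡ 1)
                   (trans (cong (σ ++_) (unfold-reverse a ρ)) (sym (++-assoc σ (reverse ρ) (a ∷ [])))) h

  -- x is accepted iff it codes a tile ⟨ σ , 1 + a , σ ∷ʳ a , 0 ⟩ with σ ∷ʳ a ∈ T and T is closed under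
  -- dropLast below x; the second condition makes T a tree as soon as tiles with arbitrarily large codes occur.
  acceptsTile : (ℕ → ℕ) → Tile → ℕ
  acceptsTile χ t = isZero (bottom t) * sg (up t) * eqℕ (right t) (snoc (left t) (up t ∸ 1)) * χ (right t)

  closedBelow : (ℕ → ℕ) → ℕ → ℕ
  closedBelow χ = ∏< (λ w → χ w ⇒ℕ χ (dropLast w))

  accepts : (ℕ → ℕ) → ℕ → ℕ
  accepts χ x = acceptsTile χ (decodeTile x) * closedBelow χ x

  acceptsᴼ : OProg 1
  acceptsᴼ = castᴼ (tileᴼ *ᴼ closedᴼ) (λ { χ (x ∷ []) → accepts χ x })
    (λ { χ (x ∷ []) → cong (acceptsTile χ (decodeTile x) *_) (correct χ x) })
    where
    leftᴼ upᴼ rightᴼ bottomᴼ : OProg 1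
    leftᴼ   = fstᴼ
    upᴼ     = app₁ fstᴼ sndᴼ
    rightᴼ  = app₁ fstᴼ (app₁ sndᴼ sndᴼ)
    bottomᴼ = app₁ sndᴼ (app₁ sndᴼ sndᴼ)
    tileᴼ : OProg 1
    tileᴼ = app₁ isZeroᴼ bottomᴼ *ᴼ app₁ sgᴼ upᴼ *ᴼ (rightᴼ ≟ᴼ app₂ snocᴼ leftᴼ (app₁ predᴼ upᴼ))
            *ᴼ app₁ oracleᴼ rightᴼ
    closedᴼ : OProg 1
    closedᴼ = recᴼ (constᴼ 1) (#1 *ᴼ (app₁ oracleᴼ #0 ⇒ᴼ app₁ oracleᴼ (app₁ dropLastᴼ #0)))
    correct : ∀ χ x → ⟦ closedᴼ ⟧₁ χ x ≡ closedBelow χ x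
    correct χ zero    = refl
    correct χ (suc x) = cong (_* (χ x ⇒ℕ χ (dropLast x))) (correct χ x)

  record BranchTile (χ : ℕ → ℕ) (t : Tile) : Set where
    field
      bottom≡0   : bottom t ≡ 0
      up>0       : 0 < up t
      right≡snoc : right t ≡ snoc (left t) (up t ∸ 1)
      right∈     : χ (right t) ≡ 1

  ClosedBelow : (ℕ → ℕ) → ℕ → Set
  ClosedBelow χ x = ∀ w → w < x → χ w ≡ 1 → χ (dropLast w) ≡ 1

  accepts-binary : ∀ {χ} → Binary χ → ∀ x → accepts χ x ≤ 1
  accepts-binary {χ} χ01 x = *-binary {acceptsTile χ t} {closedBelow χ x}
    (*-binary (*-binary (*-binary (isZero-binary (bottom t)) (sg-binary (up t)))
                        (eqℕ-binary (right t) (snoc (left t) (up t ∸ 1)))) (χ01 (right t)))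
    (∏<-binary (λ w → ⇒ℕ-binary (χ w) (χ01 (dropLast w))) x)
    where
    t : Tile
    t = decodeTile x

  accepts≡1⇒ : ∀ χ t → accepts χ (tileCode t) ≡ 1 → BranchTile χ t × ClosedBelow χ (tileCode t)
  accepts≡1⇒ χ t eq = branch , closed
    where
    a₁ a₂ a₃ a₄ : ℕ
    a₁ = isZero (bottom t)
    a₂ = sg (up t)
    a₃ = eqℕ (right t) (snoc (left t) (up t ∸ 1))
    a₄ = χ (right t)
    e₁₂₃₄ : a₁ * a₂ * a₃ * a₄ ≡ 1 × closedBelow χ (tileCode t) ≡ 1
    e₁₂₃₄ = *≡1⇒ (a₁ * a₂ * a₃ * a₄) (closedBelow χ (tileCode t))
      (subst (λ t′ → acceptsTile χ t′ * closedBelow χ (tileCode t) ≡ 1) (decodeTile-tileCode t) eq)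
    e₁₂₃ : a₁ * a₂ * a₃ ≡ 1 × a₄ ≡ 1
    e₁₂₃ = *≡1⇒ (a₁ * a₂ * a₃) a₄ (proj₁ e₁₂₃₄)
    e₁₂ : a₁ * a₂ ≡ 1 × a₃ ≡ 1
    e₁₂ = *≡1⇒ (a₁ * a₂) a₃ (proj₁ e₁₂₃)
    e₁ : a₁ ≡ 1 × a₂ ≡ 1
    e₁ = *≡1⇒ a₁ a₂ (proj₁ e₁₂)
    branch : BranchTile χ t
    branch = record
      { bottom≡0   = isZero≡1⇒≡0 _ (proj₁ e₁)
      ; up>0       = sg≡1⇒>0 _ (proj₂ e₁)
      ; right≡snoc = eqℕ≡1⇒≡ _ _ (proj₂ e₁₂)
      ; right∈     = proj₂ e₁₂₃
      }
    closed : ClosedBelow χ (tileCode t)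
    closed w w<x χw≡1 = ⇒ℕ≡1⇒ (χ w) (∏<≡1⇒ _ (tileCode t) (proj₂ e₁₂₃₄) w w<x) χw≡1

  accepts≡1⇐ : ∀ {χ} → Binary χ → DropLastClosed {χ} → ∀ t → BranchTile χ t → accepts χ (tileCode t) ≡ 1
  accepts≡1⇐ {χ} χ01 closed t branch = subst (λ t′ → acceptsTile χ t′ * closedBelow χ (tileCode t) ≡ 1)
    (sym (decodeTile-tileCode t)) (cong₂ _*_ tile≡1 closed≡1)
    where
    open BranchTile branch
    tile≡1 : acceptsTile χ t ≡ 1
    tile≡1 rewrite bottom≡0 | >0⇒sg≡1 up>0 | ≡⇒eqℕ≡1 right≡snoc | right∈ = refl
    closed≡1 : closedBelow χ (tileCode t) ≡ 1
    closed≡1 = ∏<≡1⇐ (tileCode t) (λ w _ → ⇒ℕ≡1⇐ (χ01 w) (closed w))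

module Grid where

  open import Level using (0ℓ)
  import Data.Integer as ℤ
  open import Data.Product using (_,_)
  open import Data.Sum using (inj₁; inj₂)
  open import Relation.Unary using (Pred)
  open import Relation.Binary.PropositionalEquality

  Adj-sym : ∀ {p p′} → Adj p p′ → Adj p′ p
  Adj-sym (inj₁ (x′≡ , y′≡))                = inj₂ (inj₁ (x′≡ , sym y′≡))
  Adj-sym (inj₂ (inj₁ (x≡ , y′≡)))          = inj₁ (x≡ , sym y′≡)
  Adj-sym (inj₂ (inj₂ (inj₁ (x′≡ , y′≡))))  = inj₂ (inj₂ (inj₂ (sym x′≡ , y′≡)))
  Adj-sym (inj₂ (inj₂ (inj₂ (x′≡ , y≡))))   = inj₂ (inj₂ (inj₁ (sym x′≡ , y≡)))

  module _ {R : Pred Point 0ℓ} where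

    GridPath-source : ∀ {p q} → GridPath R p q → R p
    GridPath-source (here r)     = r
    GridPath-source (step r _ _) = r

    _++ᴳ_ : ∀ {p q s} → GridPath R p q → GridPath R q s → GridPath R p s
    here _     ++ᴳ π′ = π′
    step r a π ++ᴳ π′ = step r a (π ++ᴳ π′)

    GridPath-reverse : ∀ {p q} → GridPath R p q → GridPath R q p
    GridPath-reverse (here r)     = here r
    GridPath-reverse (step r a π) = GridPath-reverse π ++ᴳ step (GridPath-source π) (Adj-sym a) (here r)

  module _ {R : Pred Point 0ℓ} (f : (p : Point) → R p → Tile) where

    MatchesHorizontally MatchesVertically : Set
    MatchesHorizontally =
      ∀ x y (r : R (x , y)) (r′ : R (x ℤ.+ ℤ.1ℤ , y)) → right (f (x , y) r) ≡ left (f (x ℤ.+ ℤ.1ℤ , y) r′)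
    MatchesVertically =
      ∀ x y (r : R (x , y)) (r′ : R (x , y ℤ.+ ℤ.1ℤ)) → up (f (x , y) r) ≡ bottom (f (x , y ℤ.+ ℤ.1ℤ) r′)

module PathToRow where

  open import Level using (0ℓ)
  open TruthValues
  open Reductions using (Ones)
  open BranchTiles
  open Grid
  open import Data.Nat
  open import Data.Nat.Properties
  open import Data.Integer as ℤ using (ℤ; +_)
  import Data.Integer.Properties as ℤ
  open import Data.List using (List; []; _∷_)
  open import Data.List.Relation.Unary.Any using (here; there)
  open import Data.List.Membership.Propositional using (_∈_)
  open import Data.Product using (Σ; _×_; _,_; proj₁)
  open import Data.Sum using (inj₁)
  open import Relation.Unary using (Pred)
  open import Relation.Nullary using (yes; no)
  open import Relation.Binary.PropositionalEquality

  Row : Pred Point 0ℓ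
  Row (x , y) = Σ ℕ λ n → x ≡ + n × y ≡ ℤ.0ℤ

  Row-infinite : Infinite Row
  Row-infinite l = (+ suc (bound l) , ℤ.0ℤ) , (suc (bound l) , refl , refl) , λ n∈l → <-irrefl refl (∈⇒≤bound n∈l)
    where
    bound : List Point → ℕ
    bound []              = 0
    bound ((x , _) ∷ l) = ℤ.∣ x ∣ + bound l
    ∈⇒≤bound : ∀ {n l} → (+ n , ℤ.0ℤ) ∈ l → n ≤ bound l
    ∈⇒≤bound {n} {(x , _) ∷ l} (here eq) = subst (λ v → n ≤ ℤ.∣ v ∣ + bound l) (cong proj₁ eq) (m≤m+n n (bound l))
    ∈⇒≤bound {n} {(x , _) ∷ l} (there n∈l) = ≤-trans (∈⇒≤bound n∈l) (m≤n+m (bound l) ℤ.∣ x ∣)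

  Row-rightwards : ∀ m k → GridPath Row (+ m , ℤ.0ℤ) (+ (k + m) , ℤ.0ℤ)
  Row-rightwards m zero    = here (m , refl , refl)
  Row-rightwards m (suc k) = subst (λ v → GridPath Row (+ m , ℤ.0ℤ) (+ v , ℤ.0ℤ)) (+-suc k m)
    (step (m , refl , refl) (inj₁ (cong +_ (+-comm 1 m) , refl)) (Row-rightwards (suc m) k))

  Row-connected : Connected Row
  Row-connected _ _ (m , refl , refl) (n , refl , refl) with m ≤? n
  ... | yes m≤n = subst (λ v → GridPath Row (+ m , ℤ.0ℤ) (+ v , ℤ.0ℤ)) (m∸n+n≡m m≤n) (Row-rightwards m (n ∸ m))
  ... | no  m≰n = GridPath-reverse
    (subst (λ v → GridPath Row (+ n , ℤ.0ℤ) (+ v , ℤ.0ℤ)) (m∸n+n≡m (≰⇒≥ m≰n)) (Row-rightwards n (m ∸ n)))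

  module _ {χ : ℕ → ℕ} (χ01 : Binary χ) (tree : IsTree (Ones χ))
           (g : ℕ → ℕ) (onPath : ∀ n → χ ⌜ restrict g n ⌝ ≡ 1) where

    pathTile : ℕ → Tile
    pathTile n = ⟨ ⌜ restrict g n ⌝ , suc (g n) , ⌜ restrict g (suc n) ⌝ , 0 ⟩

    pathTile-branch : ∀ n → BranchTile χ (pathTile n)
    pathTile-branch n = record
      { bottom≡0   = refl
      ; up>0       = s≤s z≤n
      ; right≡snoc = sym (snoc-⌜⌝ (restrict g n) (g n))
      ; right∈     = onPath (suc n)
      }

    rowTiling : TilesInfiniteConnected (Ones (accepts χ))
    rowTiling = Row , Row-infinite , Row-connected , (λ _ r → pathTile (proj₁ r)) ,
                (λ { _ (n , _) → accepts≡1⇐ χ01 (IsTree⇒DropLastClosed tree) (pathTile n) (pathTile-branch n) }) ,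
                horizontal , vertical
      where
      horizontal : MatchesHorizontally {Row} λ _ r → pathTile (proj₁ r)
      horizontal _ _ (n , refl , _) (m , n+1≡m , _) =
        cong (λ k → ⌜ restrict g k ⌝) (trans (+-comm 1 n) (ℤ.+-injective n+1≡m))
      vertical : MatchesVertically {Row} λ _ r → pathTile (proj₁ r)
      vertical _ _ (_ , _ , refl) (_ , _ , ())

  treeWithPath⇒rowTiling : ∀ {χ} → Binary χ → TreeWithPath (Ones χ) → TilesInfiniteConnected (Ones (accepts χ))
  treeWithPath⇒rowTiling χ01 (tree , g , onPath) = rowTiling χ01 tree g onPath

module RowToPath where

  open import Level using (0ℓ)
  open Coding
  open Reductions using (Ones)
  open BranchTiles
  open Grid
  open import Data.Nat
  open import Data.Nat.Properties
  open import Data.Integer as ℤ using (ℤ; +_)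
  import Data.Integer.Properties as ℤ
  open import Data.Integer.Tactic.RingSolver using (solve-∀)
  open import Data.List using (List; []; _∷_; _++_; _∷ʳ_; length; map; upTo)
  open import Data.List.Properties using (length-++; ++-assoc; ++-identityʳ)
  open import Data.List.Relation.Unary.Any using (here)
  open import Data.List.Membership.Propositional using (_∈_; _∉_)
  open import Data.List.Membership.Propositional.Properties using (∈-map⁺; ∈-upTo⁺)
  open import Data.Product using (Σ; _×_; _,_; proj₁; proj₂)
  open import Data.Sum using (_⊎_; inj₁; inj₂)
  open import Data.Empty using (⊥; ⊥-elim)
  open import Function using (_∘_)
  open import Relation.Unary using (Pred)
  open import Relation.Nullary using (yes; no)
  open import Relation.Binary.PropositionalEquality

  private
    step-offset : ∀ x A → (x ℤ.+ ℤ.1ℤ) ℤ.- (ℤ.1ℤ ℤ.+ A) ≡ x ℤ.- A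
    step-offset = solve-∀

    x≡[x-A]+A : ∀ x A → x ≡ (x ℤ.- A) ℤ.+ A
    x≡[x-A]+A = solve-∀

    A≡[D+A]-D : ∀ D A → A ≡ (D ℤ.+ A) ℤ.- D
    A≡[D+A]-D = solve-∀

    +-cancelˡ : ∀ D A B → D ℤ.+ A ≡ D ℤ.+ B → A ≡ B
    +-cancelˡ D A B eq = trans (A≡[D+A]-D D A) (trans (cong (ℤ._- D) eq) (sym (A≡[D+A]-D D B)))

  length-snoc : ∀ w a → length (decode (snoc w a)) ≡ suc (length (decode w))
  length-snoc w a = trans (cong length (decode-⌜⌝ (decode w ∷ʳ a))) (trans (length-++ (decode w)) (+-comm (length (decode w)) 1))

  restrict-+ : ∀ g n k → restrict g (n + k) ≡ restrict g n ++ restrict (λ i → g (n + i)) k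
  restrict-+ g n zero    = trans (cong (restrict g) (+-identityʳ n)) (sym (++-identityʳ (restrict g n)))
  restrict-+ g n (suc k) = begin
    restrict g (n + suc k)                                          ≡⟨ cong (restrict g) (+-suc n k) ⟩
    restrict g (n + k) ∷ʳ g (n + k)                                 ≡⟨ cong (_∷ʳ g (n + k)) (restrict-+ g n k) ⟩
    (restrict g n ++ restrict (λ i → g (n + i)) k) ∷ʳ g (n + k)      ≡⟨ ++-assoc (restrict g n) _ _ ⟩
    restrict g n ++ restrict (λ i → g (n + i)) (suc k)              ∎
    where open ≡-Reasoning

  restrict-suc : ∀ g n → restrict g (suc n) ≡ g 0 ∷ restrict (λ i → g (suc i)) n
  restrict-suc g zero    = refl
  restrict-suc g (suc n) = cong (_∷ʳ g (suc n)) (restrict-suc g n)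

  prepend : List ℕ → (ℕ → ℕ) → ℕ → ℕ
  prepend []      a i       = a i
  prepend (x ∷ σ) a zero    = x
  prepend (x ∷ σ) a (suc i) = prepend σ a i

  restrict-prepend : ∀ σ a n → restrict (prepend σ a) (length σ + n) ≡ σ ++ restrict a n
  restrict-prepend []      a n = refl
  restrict-prepend (x ∷ σ) a n =
    trans (restrict-suc (prepend (x ∷ σ) a) (length σ + n)) (cong (x ∷_) (restrict-prepend σ a n))

  module _ {χ : ℕ → ℕ} {R : Pred Point 0ℓ} (R-infinite : Infinite R) (R-connected : Connected R)
           (f : (p : Point) → R p → Tile) (accepted : ∀ p r → accepts χ (tileCode (f p r)) ≡ 1)
           (horizontal : MatchesHorizontally f) (vertical : MatchesVertically f)
           where

    private
      branch : ∀ p r → BranchTile χ (f p r)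
      branch p r = proj₁ (accepts≡1⇒ χ (f p r) (accepted p r))

    closedBelow-at : ∀ p r → ClosedBelow χ (tileCode (f p r))
    closedBelow-at p r = proj₂ (accepts≡1⇒ χ (f p r) (accepted p r))

    -- A tile has bottom colour 0 but a positive upper colour, so no tile can sit on top of another.
    no-vertical : ∀ x y → R (x , y) → R (x , y ℤ.+ ℤ.1ℤ) → ⊥
    no-vertical x y r r′ = <⇒≢ (BranchTile.up>0 (branch _ r))
      (sym (trans (vertical x y r r′) (BranchTile.bottom≡0 (branch _ r′))))

    len : ∀ p → R p → ℕ
    len p r = length (decode (left (f p r)))

    len-step : ∀ x y (r : R (x , y)) (r′ : R (x ℤ.+ ℤ.1ℤ , y)) → len (x ℤ.+ ℤ.1ℤ , y) r′ ≡ suc (len (x , y) r)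
    len-step x y r r′ = begin
      length (decode (left (f (x ℤ.+ ℤ.1ℤ , y) r′)))          ≡⟨ cong (length ∘ decode) (horizontal x y r r′) ⟨
      length (decode (right (f (x , y) r)))                   ≡⟨ cong (length ∘ decode) (BranchTile.right≡snoc (branch _ r)) ⟩
      length (decode (snoc (left (f (x , y) r)) (up (f (x , y) r) ∸ 1))) ≡⟨ length-snoc (left (f (x , y) r)) _ ⟩
      suc (len (x , y) r)                                     ∎
      where open ≡-Reasoning

    -- The tiles along any path lie in one row, and x − len is constant along it.
    offset : ∀ p → R p → ℤ
    offset p r = proj₁ p ℤ.- + len p r

    Adj-offset : ∀ {p p′} → Adj p p′ → ∀ r r′ → proj₂ p′ ≡ proj₂ p × offset p′ r′ ≡ offset p r
    Adj-offset {x , y} (inj₁ (refl , refl)) r r′ =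
      refl , trans (cong (λ n → (x ℤ.+ ℤ.1ℤ) ℤ.- + n) (len-step x y r r′)) (step-offset x (+ len (x , y) r))
    Adj-offset {_ , y} {x′ , _} (inj₂ (inj₁ (refl , refl))) r r′ =
      refl , sym (trans (cong (λ n → (x′ ℤ.+ ℤ.1ℤ) ℤ.- + n) (len-step x′ y r′ r))
                        (step-offset x′ (+ len (x′ , y) r′)))
    Adj-offset {x , y} (inj₂ (inj₂ (inj₁ (refl , refl)))) r r′ = ⊥-elim (no-vertical x y r r′)
    Adj-offset {x , _} {_ , y′} (inj₂ (inj₂ (inj₂ (refl , refl)))) r r′ = ⊥-elim (no-vertical x y′ r′ r)

    GridPath-offset : ∀ {p q} → GridPath R p q →
                      p ≡ q ⊎ (∀ r r′ → proj₂ q ≡ proj₂ p × offset q r′ ≡ offset p r)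
    GridPath-offset (here _) = inj₁ refl
    GridPath-offset (step r a π) with GridPath-offset π
    ... | inj₁ refl = inj₂ (Adj-offset a)
    ... | inj₂ rest = inj₂ λ rp rq →
      let (y₁ , o₁) = Adj-offset a rp (GridPath-source π)
          (y₂ , o₂) = rest (GridPath-source π) rq
      in trans y₂ y₁ , trans o₂ o₁

    Adj-len : ∀ {p p′} → Adj p p′ → ∀ r r′ → len p′ r′ ≤ suc (len p r)
    Adj-len {x , y} (inj₁ (refl , refl)) r r′ = ≤-reflexive (len-step x y r r′)
    Adj-len {_ , y} {x′ , _} (inj₂ (inj₁ (refl , refl))) r r′ =
      subst (λ n → len (x′ , y) r′ ≤ suc n) (sym (len-step x′ y r′ r)) (≤-trans (n≤1+n _) (n≤1+n _))
    Adj-len {x , y} (inj₂ (inj₂ (inj₁ (refl , refl)))) r r′ = ⊥-elim (no-vertical x y r r′)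
    Adj-len {x , _} {_ , y′} (inj₂ (inj₂ (inj₂ (refl , refl)))) r r′ = ⊥-elim (no-vertical x y′ r′ r)

    private
      base : Σ Point λ q → R q × q ∉ []
      base = R-infinite []

    q₀ : Point
    q₀ = proj₁ base

    r₀ : R q₀
    r₀ = proj₁ (proj₂ base)

    D₀ : ℤ
    D₀ = offset q₀ r₀

    y₀ : ℤ
    y₀ = proj₂ q₀

    n₀ : ℕ
    n₀ = len q₀ r₀

    -- Since the colours at a point may depend on the membership proof, q₀ is compared through a second point.
    offset-q₀ : ∀ r → offset q₀ r ≡ D₀
    offset-q₀ r with R-infinite (q₀ ∷ [])
    ... | q₁ , r₁ , q₁∉ with GridPath-offset (R-connected q₀ q₁ r₀ r₁)
    ... | inj₁ q₀≡q₁ = ⊥-elim (q₁∉ (here (sym q₀≡q₁)))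
    ... | inj₂ along = trans (sym (proj₂ (along r r₁))) (proj₂ (along r₀ r₁))

    on-line : ∀ q r → proj₂ q ≡ y₀ × offset q r ≡ D₀
    on-line q r with GridPath-offset (R-connected q₀ q r₀ r)
    ... | inj₁ refl  = refl , offset-q₀ r
    ... | inj₂ along = along r₀ r

    position : ∀ q r → q ≡ (D₀ ℤ.+ + len q r , y₀)
    position (x , y) r =
      cong₂ _,_ (trans (x≡[x-A]+A x (+ len (x , y) r)) (cong (ℤ._+ + len (x , y) r) (proj₂ (on-line (x , y) r))))
                                   (proj₁ (on-line (x , y) r))

    len-irrelevant : ∀ q r r′ → len q r ≡ len q r′
    len-irrelevant q r r′ = ℤ.+-injective
      (+-cancelˡ D₀ (+ len q r) (+ len q r′) (trans (sym (cong proj₁ (position q r))) (cong proj₁ (position q r′))))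

    position-of-len : ∀ q r k → k ≡ len q r → R (D₀ ℤ.+ + k , y₀)
    position-of-len q r k refl = subst R (position q r) r

    intermediate : ∀ {p q} → GridPath R p q → ∀ rp rq k → len p rp ≤ k → k ≤ len q rq → R (D₀ ℤ.+ + k , y₀)
    intermediate {p} (here _) rp rq k p≤k k≤q =
      position-of-len p rp k (≤-antisym (≤-trans k≤q (≤-reflexive (len-irrelevant p rq rp))) p≤k)
    intermediate {p} (step _ a π) rp rq k p≤k k≤q with k ≟ len p rp
    ... | yes k≡p = position-of-len p rp k k≡p
    ... | no  k≢p = intermediate π (GridPath-source π) rq k
      (≤-trans (Adj-len a rp (GridPath-source π)) (≤∧≢⇒< p≤k (λ p≡k → k≢p (sym p≡k)))) k≤q

    ray-point : ℕ → Point
    ray-point m = D₀ ℤ.+ + (n₀ + m) , y₀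

    -- Infinitely many points lie on the row, so one of them lies beyond ray-point m.
    ray : ∀ m → R (ray-point m)
    ray m with R-infinite (map (λ k → D₀ ℤ.+ + k , y₀) (upTo (suc (n₀ + m))))
    ... | q , r , q∉ with len q r ≤? n₀ + m
    ...   | yes q≤ =
      ⊥-elim (q∉ (subst (_∈ _) (sym (position q r)) (∈-map⁺ (λ k → D₀ ℤ.+ + k , y₀) (∈-upTo⁺ (s≤s q≤)))))
    ...   | no  q≰ =
      intermediate (R-connected q₀ q r₀ r) r₀ r (n₀ + m) (m≤m+n n₀ m) (≤-trans (n≤1+n (n₀ + m)) (≰⇒> q≰))

    len-ray : ∀ m → len (ray-point m) (ray m) ≡ n₀ + m
    len-ray m = sym (ℤ.+-injective
      (+-cancelˡ D₀ (+ (n₀ + m)) (+ len (ray-point m) (ray m)) (cong proj₁ (position (ray-point m) (ray m)))))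

    rayTile : ℕ → Tile
    rayTile m = f (ray-point m) (ray m)

    letter : ℕ → ℕ
    letter m = up (rayTile m) ∸ 1

    label : ℕ → List ℕ
    label m = decode (left (rayTile m))

    right-rayTile : ∀ m → right (rayTile m) ≡ left (rayTile (suc m))
    right-rayTile m = adjacent (ray m) (ray (suc m)) ray-point-suc
      where
      adjacent : ∀ {x x′} (r : R (x , y₀)) (r′ : R (x′ , y₀)) → x′ ≡ x ℤ.+ ℤ.1ℤ →
                 right (f (x , y₀) r) ≡ left (f (x′ , y₀) r′)
      adjacent {x} r r′ refl = horizontal x y₀ r r′
      ray-point-suc : D₀ ℤ.+ + (n₀ + suc m) ≡ (D₀ ℤ.+ + (n₀ + m)) ℤ.+ ℤ.1ℤ
      ray-point-suc = begin
        D₀ ℤ.+ + (n₀ + suc m)              ≡⟨ cong (λ k → D₀ ℤ.+ + k) (trans (+-suc n₀ m) (+-comm 1 (n₀ + m))) ⟩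
        D₀ ℤ.+ + (n₀ + m + 1)              ≡⟨ cong (λ k → D₀ ℤ.+ k) (ℤ.pos-+ (n₀ + m) 1) ⟩
        D₀ ℤ.+ (+ (n₀ + m) ℤ.+ ℤ.1ℤ)       ≡⟨ ℤ.+-assoc D₀ (+ (n₀ + m)) ℤ.1ℤ ⟨
        (D₀ ℤ.+ + (n₀ + m)) ℤ.+ ℤ.1ℤ       ∎
        where open ≡-Reasoning

    label-suc : ∀ m → label (suc m) ≡ label m ∷ʳ letter m
    label-suc m = begin
      decode (left (rayTile (suc m)))               ≡⟨ cong decode (right-rayTile m) ⟨
      decode (right (rayTile m))                    ≡⟨ cong decode (BranchTile.right≡snoc (branch _ (ray m))) ⟩
      decode ⌜ label m ∷ʳ letter m ⌝                ≡⟨ decode-⌜⌝ (label m ∷ʳ letter m) ⟩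
      label m ∷ʳ letter m                           ∎
      where open ≡-Reasoning

    label-in-tree : ∀ m → χ ⌜ label (suc m) ⌝ ≡ 1
    label-in-tree m =
      subst (λ v → χ v ≡ 1) (trans (right-rayTile m) (sym (⌜decode⌝ _))) (BranchTile.right∈ (branch _ (ray m)))

    -- The tile at ray-point (1 + w) has a code above w, so its closedness condition covers w.
    dropLast-closed : DropLastClosed {χ}
    dropLast-closed w = closedBelow-at _ (ray (suc w)) w w<code
      where
      t : Tile
      t = rayTile (suc w)
      w<code : w < tileCode t
      w<code = begin-strict
        w                          <⟨ n<1+n w ⟩
        suc w                      ≤⟨ m≤n+m (suc w) n₀ ⟩
        n₀ + suc w                 ≡⟨ len-ray (suc w) ⟨
        length (decode (left t))   ≤⟨ length-decode≤ (left t) ⟩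
        left t                     ≤⟨ a≤pair (left t) (pair (up t) (pair (right t) (bottom t))) ⟩
        tileCode t                 ∎
        where open ≤-Reasoning

    label-prefix : ∀ m → label m ≡ label 0 ++ restrict letter m
    label-prefix zero    = sym (++-identityʳ (label 0))
    label-prefix (suc m) = trans (label-suc m) (trans (cong (_∷ʳ letter m) (label-prefix m)) (++-assoc (label 0) _ _))

    branchPath : ℕ → ℕ
    branchPath = prepend (label 0) letter

    branchPath-in-tree : ∀ n → χ ⌜ restrict branchPath n ⌝ ≡ 1
    branchPath-in-tree n = DropLastClosed⇒IsTree dropLast-closed (restrict branchPath n) _
      (subst (λ σ → χ ⌜ σ ⌝ ≡ 1) label≡ (label-in-tree n))
      where
      L : ℕ
      L = length (label 0)
      label≡ : label (suc n) ≡ restrict branchPath n ++ restrict (λ i → branchPath (n + i)) (suc L)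
      label≡ = begin
        label (suc n)                                 ≡⟨ label-prefix (suc n) ⟩
        label 0 ++ restrict letter (suc n)            ≡⟨ restrict-prepend (label 0) letter (suc n) ⟨
        restrict branchPath (L + suc n)               ≡⟨ cong (restrict branchPath) (trans (+-suc L n) (cong suc (+-comm L n))) ⟩
        restrict branchPath (suc (n + L))             ≡⟨ cong (restrict branchPath) (+-suc n L) ⟨
        restrict branchPath (n + suc L)               ≡⟨ restrict-+ branchPath n (suc L) ⟩
        restrict branchPath n ++ restrict (λ i → branchPath (n + i)) (suc L) ∎
        where open ≡-Reasoning

  tiling⇒treeWithPath : ∀ {χ} → TilesInfiniteConnected (Ones (accepts χ)) → TreeWithPath (Ones χ)
  tiling⇒treeWithPath {χ} (_ , inf , conn , f , inS , horizontal , vertical) =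
    DropLastClosed⇒IsTree {χ} (dropLast-closed inf conn f inS horizontal vertical) ,
    branchPath {χ} inf conn f inS horizontal vertical , branchPath-in-tree {χ} inf conn f inS horizontal vertical

module Entries where

  open Coding
  open Arithmetic using (eqℕ; isZero; _⇒ℕ_)
  open TruthValues
  open import Data.Nat
  open import Data.Nat.Properties using (0≢1+n; ≤-trans; m≤m+n; m≤n+m)
  open import Data.Integer as ℤ using (ℤ; +_; -[1+_])
  import Data.Integer.Properties as ℤ
  open import Data.Integer.Tactic.RingSolver using (solve-∀)
  open import Data.Product using (_×_; _,_; proj₁; proj₂)
  open import Data.Sum using (_⊎_; inj₁; inj₂)
  open import Data.Empty using (⊥-elim)
  open import Relation.Binary.PropositionalEquality

  -- Integers are coded by pairs (a , b) standing for a − b.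
  decodeℤ : ℕ → ℤ
  decodeℤ w = + fst w ℤ.- + snd w

  encodeℤ : ℤ → ℕ
  encodeℤ (+ n)      = pair n 0
  encodeℤ -[1+ n ]   = pair 0 (suc n)

  decodeℤ-encodeℤ : ∀ x → decodeℤ (encodeℤ x) ≡ x
  decodeℤ-encodeℤ (+ n)    rewrite fst-pair n 0 | snd-pair n 0 = ℤ.+-identityʳ (+ n)
  decodeℤ-encodeℤ -[1+ n ] rewrite fst-pair 0 (suc n) | snd-pair 0 (suc n) = refl

  sameℤ succℤ : ℕ → ℕ → ℕ
  sameℤ w w′ = eqℕ (fst w′ + snd w) (fst w + snd w′)
  succℤ w w′ = eqℕ (fst w′ + snd w) (suc (fst w + snd w′))

  sameℤ-binary : ∀ w w′ → sameℤ w w′ ≤ 1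
  sameℤ-binary w w′ = eqℕ-binary (fst w′ + snd w) (fst w + snd w′)

  succℤ-binary : ∀ w w′ → succℤ w w′ ≤ 1
  succℤ-binary w w′ = eqℕ-binary (fst w′ + snd w) (suc (fst w + snd w′))

  private
    shift⇐ : ∀ w w′ k → fst w′ + snd w ≡ k + (fst w + snd w′) → decodeℤ w′ ≡ decodeℤ w ℤ.+ + k
    shift⇐ w w′ k eq = begin
      A′ ℤ.- B′                         ≡⟨ i₁ A′ B B′ ⟩
      (A′ ℤ.+ B) ℤ.- (B ℤ.+ B′)          ≡⟨ cong (ℤ._- (B ℤ.+ B′)) (sym (ℤ.pos-+ (fst w′) (snd w))) ⟩
      + (fst w′ + snd w) ℤ.- (B ℤ.+ B′)  ≡⟨ cong (λ n → + n ℤ.- (B ℤ.+ B′)) eq ⟩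
      + (k + (fst w + snd w′)) ℤ.- (B ℤ.+ B′)
        ≡⟨ cong (ℤ._- (B ℤ.+ B′)) (trans (ℤ.pos-+ k _) (cong (λ z → + k ℤ.+ z) (ℤ.pos-+ (fst w) (snd w′)))) ⟩
      (+ k ℤ.+ (A ℤ.+ B′)) ℤ.- (B ℤ.+ B′) ≡⟨ i₂ A B B′ (+ k) ⟩
      (A ℤ.- B) ℤ.+ + k                 ∎
      where
      open ≡-Reasoning
      A B A′ B′ : ℤ
      A = + fst w ; B = + snd w ; A′ = + fst w′ ; B′ = + snd w′
      i₁ : ∀ A′ B B′ → A′ ℤ.- B′ ≡ (A′ ℤ.+ B) ℤ.- (B ℤ.+ B′)
      i₁ = solve-∀
      i₂ : ∀ A B B′ K → (K ℤ.+ (A ℤ.+ B′)) ℤ.- (B ℤ.+ B′) ≡ (A ℤ.- B) ℤ.+ K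
      i₂ = solve-∀

    shift⇒ : ∀ w w′ k → decodeℤ w′ ≡ decodeℤ w ℤ.+ + k → fst w′ + snd w ≡ k + (fst w + snd w′)
    shift⇒ w w′ k eq = ℤ.+-injective (begin
      + (fst w′ + snd w)                ≡⟨ ℤ.pos-+ (fst w′) (snd w) ⟩
      A′ ℤ.+ B                          ≡⟨ i₁ A′ B B′ ⟩
      (A′ ℤ.- B′) ℤ.+ (B ℤ.+ B′)         ≡⟨ cong (ℤ._+ (B ℤ.+ B′)) eq ⟩
      ((A ℤ.- B) ℤ.+ + k) ℤ.+ (B ℤ.+ B′) ≡⟨ i₂ A B B′ (+ k) ⟩
      + k ℤ.+ (A ℤ.+ B′)
        ≡⟨ trans (cong (λ z → + k ℤ.+ z) (ℤ.pos-+ (fst w) (snd w′))) (ℤ.pos-+ k _) ⟨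
      + (k + (fst w + snd w′))          ∎)
      where
      open ≡-Reasoning
      A B A′ B′ : ℤ
      A = + fst w ; B = + snd w ; A′ = + fst w′ ; B′ = + snd w′
      i₁ : ∀ A′ B B′ → A′ ℤ.+ B ≡ (A′ ℤ.- B′) ℤ.+ (B ℤ.+ B′)
      i₁ = solve-∀
      i₂ : ∀ A B B′ K → ((A ℤ.- B) ℤ.+ K) ℤ.+ (B ℤ.+ B′) ≡ K ℤ.+ (A ℤ.+ B′)
      i₂ = solve-∀

  sameℤ≡1⇒ : ∀ w w′ → sameℤ w w′ ≡ 1 → decodeℤ w′ ≡ decodeℤ w
  sameℤ≡1⇒ w w′ eq = trans (shift⇐ w w′ 0 (eqℕ≡1⇒≡ _ _ eq)) (ℤ.+-identityʳ (decodeℤ w))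

  sameℤ≡1⇐ : ∀ w w′ → decodeℤ w′ ≡ decodeℤ w → sameℤ w w′ ≡ 1
  sameℤ≡1⇐ w w′ eq = ≡⇒eqℕ≡1 (shift⇒ w w′ 0 (trans eq (sym (ℤ.+-identityʳ (decodeℤ w)))))

  succℤ≡1⇒ : ∀ w w′ → succℤ w w′ ≡ 1 → decodeℤ w′ ≡ decodeℤ w ℤ.+ ℤ.1ℤ
  succℤ≡1⇒ w w′ eq = shift⇐ w w′ 1 (eqℕ≡1⇒≡ _ _ eq)

  succℤ≡1⇐ : ∀ w w′ → decodeℤ w′ ≡ decodeℤ w ℤ.+ ℤ.1ℤ → succℤ w w′ ≡ 1
  succℤ≡1⇐ w w′ eq = ≡⇒eqℕ≡1 (shift⇒ w w′ 1 eq)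

  entry : Point → Tile → ℕ
  entry (x , y) t = pair (pair (encodeℤ x) (encodeℤ y)) (tileCode t)

  xCode yCode : ℕ → ℕ
  xCode e = fst (fst e)
  yCode e = snd (fst e)

  entryPoint : ℕ → Point
  entryPoint e = decodeℤ (xCode e) , decodeℤ (yCode e)

  entryTile : ℕ → Tile
  entryTile e = decodeTile (snd e)

  entryPoint-entry : ∀ p t → entryPoint (entry p t) ≡ p
  entryPoint-entry (x , y) t
    rewrite fst-pair (pair (encodeℤ x) (encodeℤ y)) (tileCode t)
          | fst-pair (encodeℤ x) (encodeℤ y) | snd-pair (encodeℤ x) (encodeℤ y)
    = cong₂ _,_ (decodeℤ-encodeℤ x) (decodeℤ-encodeℤ y)

  snd-entry : ∀ p t → snd (entry p t) ≡ tileCode t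
  snd-entry (x , y) t = snd-pair (pair (encodeℤ x) (encodeℤ y)) (tileCode t)

  entryTile-entry : ∀ p t → entryTile (entry p t) ≡ t
  entryTile-entry p t = trans (cong decodeTile (snd-entry p t)) (decodeTile-tileCode t)

  RightOf Above : Point → Point → Set
  RightOf (x , y) (x′ , y′) = x′ ≡ x ℤ.+ ℤ.1ℤ × y′ ≡ y
  Above   (x , y) (x′ , y′) = x′ ≡ x × y′ ≡ y ℤ.+ ℤ.1ℤ

  RightOf-at : ∀ {p p′ x y} → p ≡ (x , y) → p′ ≡ (x ℤ.+ ℤ.1ℤ , y) → RightOf p p′
  RightOf-at refl refl = refl , refl

  Above-at : ∀ {p p′ x y} → p ≡ (x , y) → p′ ≡ (x , y ℤ.+ ℤ.1ℤ) → Above p p′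
  Above-at refl refl = refl , refl

  isRight isAbove : ℕ → ℕ → ℕ
  isRight e e′ = succℤ (xCode e) (xCode e′) * sameℤ (yCode e) (yCode e′)
  isAbove e e′ = sameℤ (xCode e) (xCode e′) * succℤ (yCode e) (yCode e′)

  isRight-binary : ∀ e e′ → isRight e e′ ≤ 1
  isRight-binary e e′ = *-binary {succℤ (xCode e) (xCode e′)} {sameℤ (yCode e) (yCode e′)}
    (succℤ-binary (xCode e) (xCode e′)) (sameℤ-binary (yCode e) (yCode e′))

  isAbove-binary : ∀ e e′ → isAbove e e′ ≤ 1
  isAbove-binary e e′ = *-binary {sameℤ (xCode e) (xCode e′)} {succℤ (yCode e) (yCode e′)}
    (sameℤ-binary (xCode e) (xCode e′)) (succℤ-binary (yCode e) (yCode e′))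

  isRight≡1⇒ : ∀ e e′ → isRight e e′ ≡ 1 → RightOf (entryPoint e) (entryPoint e′)
  isRight≡1⇒ e e′ eq with *≡1⇒ (succℤ (xCode e) (xCode e′)) (sameℤ (yCode e) (yCode e′)) eq
  ... | x≡ , y≡ = succℤ≡1⇒ (xCode e) (xCode e′) x≡ , sameℤ≡1⇒ (yCode e) (yCode e′) y≡

  isRight≡1⇐ : ∀ e e′ → RightOf (entryPoint e) (entryPoint e′) → isRight e e′ ≡ 1
  isRight≡1⇐ e e′ (x≡ , y≡) =
    cong₂ _*_ (succℤ≡1⇐ (xCode e) (xCode e′) x≡) (sameℤ≡1⇐ (yCode e) (yCode e′) y≡)

  isAbove≡1⇒ : ∀ e e′ → isAbove e e′ ≡ 1 → Above (entryPoint e) (entryPoint e′)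
  isAbove≡1⇒ e e′ eq with *≡1⇒ (sameℤ (xCode e) (xCode e′)) (succℤ (yCode e) (yCode e′)) eq
  ... | x≡ , y≡ = sameℤ≡1⇒ (xCode e) (xCode e′) x≡ , succℤ≡1⇒ (yCode e) (yCode e′) y≡

  isAbove≡1⇐ : ∀ e e′ → Above (entryPoint e) (entryPoint e′) → isAbove e e′ ≡ 1
  isAbove≡1⇐ e e′ (x≡ , y≡) =
    cong₂ _*_ (sameℤ≡1⇐ (xCode e) (xCode e′) x≡) (succℤ≡1⇐ (yCode e) (yCode e′) y≡)

  matches : ℕ → ℕ → ℕ
  matches e e′ = (isRight e e′ ⇒ℕ eqℕ (right t) (left t′)) * (isAbove e e′ ⇒ℕ eqℕ (up t) (bottom t′))
    where
    t t′ : Tile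
    t = entryTile e
    t′ = entryTile e′

  consistent : ℕ → ℕ → ℕ
  consistent e e′ = isZero (sameℤ (xCode e) (xCode e′) * sameℤ (yCode e) (yCode e′)) * matches e e′ * matches e′ e

  adjacent : ℕ → ℕ → ℕ
  adjacent e e′ = isRight e e′ + isRight e′ e + isAbove e e′ + isAbove e′ e

  Matches : Point → Tile → Point → Tile → Set
  Matches p t p′ t′ = (RightOf p p′ → right t ≡ left t′) × (Above p p′ → up t ≡ bottom t′)

  record Consistent (e e′ : ℕ) : Set where
    field
      distinct : entryPoint e′ ≢ entryPoint e
      matches→ : Matches (entryPoint e) (entryTile e) (entryPoint e′) (entryTile e′)
      matches← : Matches (entryPoint e′) (entryTile e′) (entryPoint e) (entryTile e)

  matches-binary : ∀ e e′ → matches e e′ ≤ 1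
  matches-binary e e′ = *-binary {isRight e e′ ⇒ℕ eqℕ (right t) (left t′)} {isAbove e e′ ⇒ℕ eqℕ (up t) (bottom t′)}
    (⇒ℕ-binary (isRight e e′) (eqℕ-binary (right t) (left t′)))
    (⇒ℕ-binary (isAbove e e′) (eqℕ-binary (up t) (bottom t′)))
    where
    t t′ : Tile
    t = entryTile e
    t′ = entryTile e′

  consistent-binary : ∀ e e′ → consistent e e′ ≤ 1
  consistent-binary e e′ = *-binary {isZero (sameℤ (xCode e) (xCode e′) * sameℤ (yCode e) (yCode e′)) * matches e e′}
    (*-binary (isZero-binary (sameℤ (xCode e) (xCode e′) * sameℤ (yCode e) (yCode e′))) (matches-binary e e′))
    (matches-binary e′ e)

  matches≡1⇒ : ∀ e e′ → matches e e′ ≡ 1 → Matches (entryPoint e) (entryTile e) (entryPoint e′) (entryTile e′)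
  matches≡1⇒ e e′ eq
    with *≡1⇒ (isRight e e′ ⇒ℕ eqℕ (right t) (left t′)) (isAbove e e′ ⇒ℕ eqℕ (up t) (bottom t′)) eq
    where
    t t′ : Tile
    t = entryTile e
    t′ = entryTile e′
  ... | r≡1 , a≡1 = (λ rightOf → eqℕ≡1⇒≡ _ _ (⇒ℕ≡1⇒ (isRight e e′) r≡1 (isRight≡1⇐ e e′ rightOf))) ,
                    (λ above → eqℕ≡1⇒≡ _ _ (⇒ℕ≡1⇒ (isAbove e e′) a≡1 (isAbove≡1⇐ e e′ above)))

  matches≡1⇐ : ∀ e e′ → Matches (entryPoint e) (entryTile e) (entryPoint e′) (entryTile e′) → matches e e′ ≡ 1
  matches≡1⇐ e e′ (r , a) = cong₂ _*_
    (⇒ℕ≡1⇐ (isRight-binary e e′) (λ r≡1 → ≡⇒eqℕ≡1 (r (isRight≡1⇒ e e′ r≡1))))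
    (⇒ℕ≡1⇐ (isAbove-binary e e′) (λ a≡1 → ≡⇒eqℕ≡1 (a (isAbove≡1⇒ e e′ a≡1))))

  consistent≡1⇒ : ∀ e e′ → consistent e e′ ≡ 1 → Consistent e e′
  consistent≡1⇒ e e′ eq = record
    { distinct = λ same → 0≢1+n (trans (sym (isZero-of-same same)) (proj₁ d≡1))
    ; matches→ = matches≡1⇒ e e′ (proj₂ d≡1)
    ; matches← = matches≡1⇒ e′ e (proj₂ c≡1)
    }
    where
    sx sy : ℕ
    sx = sameℤ (xCode e) (xCode e′)
    sy = sameℤ (yCode e) (yCode e′)
    c≡1 : isZero (sx * sy) * matches e e′ ≡ 1 × matches e′ e ≡ 1
    c≡1 = *≡1⇒ (isZero (sx * sy) * matches e e′) (matches e′ e) eq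
    d≡1 : isZero (sx * sy) ≡ 1 × matches e e′ ≡ 1
    d≡1 = *≡1⇒ (isZero (sx * sy)) (matches e e′) (proj₁ c≡1)
    isZero-of-same : entryPoint e′ ≡ entryPoint e → isZero (sx * sy) ≡ 0
    isZero-of-same same rewrite sameℤ≡1⇐ (xCode e) (xCode e′) (cong proj₁ same)
                              | sameℤ≡1⇐ (yCode e) (yCode e′) (cong proj₂ same) = refl

  consistent≡1⇐ : ∀ e e′ → Consistent e e′ → consistent e e′ ≡ 1
  consistent≡1⇐ e e′ c =
    cong₂ _*_ (cong₂ _*_ distinct≡1 (matches≡1⇐ e e′ matches→)) (matches≡1⇐ e′ e matches←)
    where
    open Consistent c
    distinct≡1 : isZero (sameℤ (xCode e) (xCode e′) * sameℤ (yCode e) (yCode e′)) ≡ 1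
    distinct≡1 with binary-cases (sameℤ-binary (xCode e) (xCode e′)) | binary-cases (sameℤ-binary (yCode e) (yCode e′))
    ... | inj₁ sx≡0 | _         rewrite sx≡0 = refl
    ... | inj₂ sx≡1 | inj₁ sy≡0 rewrite sx≡1 | sy≡0 = refl
    ... | inj₂ sx≡1 | inj₂ sy≡1 =
      ⊥-elim (distinct (cong₂ _,_ (sameℤ≡1⇒ (xCode e) (xCode e′) sx≡1) (sameℤ≡1⇒ (yCode e) (yCode e′) sy≡1)))

  private
    +-pos : ∀ m {n} → 0 < m + n → 0 < m ⊎ 0 < n
    +-pos zero    pos = inj₂ pos
    +-pos (suc m) _   = inj₁ (s≤s z≤n)

    +-pos⇐ˡ : ∀ {m n} → 0 < m → 0 < m + n
    +-pos⇐ˡ {m} {n} m>0 = ≤-trans m>0 (m≤m+n m n)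

    +-pos⇐ʳ : ∀ {m n} → 0 < n → 0 < m + n
    +-pos⇐ʳ {m} {n} n>0 = ≤-trans n>0 (m≤n+m n m)

    ≡1⇒>0 : ∀ {a} → a ≡ 1 → 0 < a
    ≡1⇒>0 refl = s≤s z≤n

    pos-binary : ∀ {a} → 0 < a → a ≤ 1 → a ≡ 1
    pos-binary (s≤s z≤n) (s≤s z≤n) = refl

  adjacent>0⇒Adj : ∀ e e′ → 0 < adjacent e e′ → Adj (entryPoint e) (entryPoint e′)
  adjacent>0⇒Adj e e′ pos with +-pos (isRight e e′ + isRight e′ e + isAbove e e′) pos
  ... | inj₂ d>0 = let (x≡ , y≡) = isAbove≡1⇒ e′ e (pos-binary d>0 (isAbove-binary e′ e))
                  in inj₂ (inj₂ (inj₂ (sym x≡ , y≡)))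
  ... | inj₁ abc>0 with +-pos (isRight e e′ + isRight e′ e) abc>0
  ...   | inj₂ c>0 = inj₂ (inj₂ (inj₁ (isAbove≡1⇒ e e′ (pos-binary c>0 (isAbove-binary e e′)))))
  ...   | inj₁ ab>0 with +-pos (isRight e e′) ab>0
  ...     | inj₁ a>0 = inj₁ (isRight≡1⇒ e e′ (pos-binary a>0 (isRight-binary e e′)))
  ...     | inj₂ b>0 = let (x≡ , y≡) = isRight≡1⇒ e′ e (pos-binary b>0 (isRight-binary e′ e))
                      in inj₂ (inj₁ (x≡ , sym y≡))

  Adj⇒adjacent>0 : ∀ e e′ → Adj (entryPoint e) (entryPoint e′) → 0 < adjacent e e′
  Adj⇒adjacent>0 e e′ (inj₁ rightOf) =
    +-pos⇐ˡ (+-pos⇐ˡ (+-pos⇐ˡ (≡1⇒>0 (isRight≡1⇐ e e′ rightOf))))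
  Adj⇒adjacent>0 e e′ (inj₂ (inj₁ (x≡ , y≡))) =
    +-pos⇐ˡ (+-pos⇐ˡ (+-pos⇐ʳ {isRight e e′} (≡1⇒>0 (isRight≡1⇐ e′ e (x≡ , sym y≡)))))
  Adj⇒adjacent>0 e e′ (inj₂ (inj₂ (inj₁ above))) =
    +-pos⇐ˡ (+-pos⇐ʳ {isRight e e′ + isRight e′ e} (≡1⇒>0 (isAbove≡1⇐ e e′ above)))
  Adj⇒adjacent>0 e e′ (inj₂ (inj₂ (inj₂ (x≡ , y≡)))) =
    +-pos⇐ʳ {isRight e e′ + isRight e′ e + isAbove e e′} (≡1⇒>0 (isAbove≡1⇐ e′ e (sym x≡ , y≡)))

  Consistent-entry : ∀ {p t p′ t′} → p′ ≢ p → Matches p t p′ t′ → Matches p′ t′ p t →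
                     Consistent (entry p t) (entry p′ t′)
  Consistent-entry {p} {t} {p′} {t′} =
    transport (entryPoint-entry p t) (entryTile-entry p t) (entryPoint-entry p′ t′) (entryTile-entry p′ t′)
    where
    transport : ∀ {e e′ q s q′ s′} →
                entryPoint e ≡ q → entryTile e ≡ s → entryPoint e′ ≡ q′ → entryTile e′ ≡ s′ →
                q′ ≢ q → Matches q s q′ s′ → Matches q′ s′ q s → Consistent e e′
    transport refl refl refl refl q′≢q m m′ = record { distinct = q′≢q ; matches→ = m ; matches← = m′ }

module PartialTilings where

  open Coding
  open OraclePrograms
  open Arithmetic
  open Folds
  open TruthValues
  open BranchTiles using (snoc; snocᴼ; snoc-⌜⌝)
  open Entries
  open import Data.Nat
  open import Data.Nat.Properties
  open import Data.Vec using ([]; _∷_)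
  open import Data.List using ([]; _∷_; _++_; _∷ʳ_; foldl)
  open import Data.List.Properties using (foldl-++)
  open import Data.Product using (Σ; _×_; _,_; proj₁; proj₂)
  open import Data.Sum using (inj₁; inj₂)
  open import Data.Empty using (⊥-elim)
  open import Relation.Binary.PropositionalEquality

  module _ {n} (e e′ : OProg n) where

    private
      xCodeᴼ yCodeᴼ : OProg n → OProg n
      xCodeᴼ d = app₁ fstᴼ (app₁ fstᴼ d)
      yCodeᴼ d = app₁ sndᴼ (app₁ fstᴼ d)

      sameℤᴼ succℤᴼ : OProg n → OProg n → OProg n
      sameℤᴼ w w′ = (app₁ fstᴼ w′ +ᴼ app₁ sndᴼ w) ≟ᴼ (app₁ fstᴼ w +ᴼ app₁ sndᴼ w′)
      succℤᴼ w w′ = (app₁ fstᴼ w′ +ᴼ app₁ sndᴼ w) ≟ᴼ app₁ sucᴼ (app₁ fstᴼ w +ᴼ app₁ sndᴼ w′)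

      isRightᴼ isAboveᴼ : OProg n → OProg n → OProg n
      isRightᴼ d d′ = succℤᴼ (xCodeᴼ d) (xCodeᴼ d′) *ᴼ sameℤᴼ (yCodeᴼ d) (yCodeᴼ d′)
      isAboveᴼ d d′ = sameℤᴼ (xCodeᴼ d) (xCodeᴼ d′) *ᴼ succℤᴼ (yCodeᴼ d) (yCodeᴼ d′)

      leftᴼ upᴼ rightᴼ bottomᴼ : OProg n → OProg n
      leftᴼ   d = app₁ fstᴼ (app₁ sndᴼ d)
      upᴼ     d = app₁ fstᴼ (app₁ sndᴼ (app₁ sndᴼ d))
      rightᴼ  d = app₁ fstᴼ (app₁ sndᴼ (app₁ sndᴼ (app₁ sndᴼ d)))
      bottomᴼ d = app₁ sndᴼ (app₁ sndᴼ (app₁ sndᴼ (app₁ sndᴼ d)))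

      matchesᴼ : OProg n → OProg n → OProg n
      matchesᴼ d d′ = (isRightᴼ d d′ ⇒ᴼ (rightᴼ d ≟ᴼ leftᴼ d′))
                   *ᴼ (isAboveᴼ d d′ ⇒ᴼ (upᴼ d ≟ᴼ bottomᴼ d′))

    consistentᴼ adjacentᴼ : OProg n
    consistentᴼ = app₁ isZeroᴼ (sameℤᴼ (xCodeᴼ e) (xCodeᴼ e′) *ᴼ sameℤᴼ (yCodeᴼ e) (yCodeᴼ e′))
                  *ᴼ matchesᴼ e e′ *ᴼ matchesᴼ e′ e
    adjacentᴼ = isRightᴼ e e′ +ᴼ isRightᴼ e′ e +ᴼ isAboveᴼ e e′ +ᴼ isAboveᴼ e′ e

  compatible : (ℕ → ℕ) → ℕ → ℕ → ℕ
  compatible χ e prev = χ (snd e) * foldl (λ acc a → acc * consistent e a) 1 (decode prev)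
                        * (prev ⇒ℕ sg (foldl (λ acc a → acc + adjacent e a) 0 (decode prev)))

  compatibleᴼ : OProg 2
  compatibleᴼ = app₁ oracleᴼ (app₁ sndᴼ #0) *ᴼ compᴼ consistentAllᴼ (#1 ∷ #0 ∷ [])
                *ᴼ (#1 ⇒ᴼ app₁ sgᴼ (compᴼ adjacentSumᴼ (#1 ∷ #0 ∷ [])))
    where
    consistentAllᴼ adjacentSumᴼ : OProg 2
    consistentAllᴼ = foldlᴼ (constᴼ 1) (#0 *ᴼ consistentᴼ #2 #1)
    adjacentSumᴼ = foldlᴼ zeroᴼ (#0 +ᴼ adjacentᴼ #2 #1)

  -- A list of entries is valid iff every entry is compatible with the entries before it;
  -- the state is (validity flag so far , code of the entries read so far).
  readEntry : (ℕ → ℕ) → ℕ → ℕ → ℕ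
  readEntry χ st e = pair (fst st * compatible χ e (snd st)) (snoc (snd st) e)

  valid : (ℕ → ℕ) → ℕ → ℕ
  valid χ s = fst (foldl (readEntry χ) (pair 1 0) (decode s))

  validᴼ : OProg 1
  validᴼ = castᴼ (app₁ fstᴼ (foldlᴼ (constᴼ (pair 1 0)) stepᴼ)) (λ { χ (s ∷ []) → valid χ s })
    (λ { χ (s ∷ []) → refl })
    where
    stepᴼ : OProg 2
    stepᴼ = app₂ pairᴼ (app₁ fstᴼ #0 *ᴼ compᴼ compatibleᴼ (#1 ∷ app₁ sndᴼ #0 ∷ []))
                       (app₂ snocᴼ (app₁ sndᴼ #0) #1)

  foldl-restrict : ∀ {A : Set} (f : A → ℕ → A) z (g : ℕ → ℕ) n →
                   foldl f z (restrict g (suc n)) ≡ f (foldl f z (restrict g n)) (g n)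
  foldl-restrict f z g n = foldl-++ f z (restrict g n) (g n ∷ [])

  foldl-*-restrict : ∀ (h g : ℕ → ℕ) n → foldl (λ acc a → acc * h a) 1 (restrict g n) ≡ ∏< (λ j → h (g j)) n
  foldl-*-restrict h g zero    = refl
  foldl-*-restrict h g (suc n) = trans (foldl-restrict (λ acc a → acc * h a) 1 g n) (cong (_* h (g n)) (foldl-*-restrict h g n))

  foldl-+-restrict : ∀ (h g : ℕ → ℕ) n → foldl (λ acc a → acc + h a) 0 (restrict g n) ≡ ∑< (λ j → h (g j)) n
  foldl-+-restrict h g zero    = refl
  foldl-+-restrict h g (suc n) = trans (foldl-restrict (λ acc a → acc + h a) 0 g n) (cong (_+ h (g n)) (foldl-+-restrict h g n))

  ⌜∷ʳ⌝>0 : ∀ σ a → 0 < ⌜ σ ∷ʳ a ⌝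
  ⌜∷ʳ⌝>0 []      a = s≤s z≤n
  ⌜∷ʳ⌝>0 (_ ∷ _) a = s≤s z≤n

  module _ (χ : ℕ → ℕ) (g : ℕ → ℕ) where

    compatibleAt : ℕ → ℕ
    compatibleAt k = compatible χ (g k) ⌜ restrict g k ⌝

    valid-restrict : ∀ n → valid χ ⌜ restrict g n ⌝ ≡ ∏< compatibleAt n
    valid-restrict n = trans (cong (λ σ → fst (foldl (readEntry χ) (pair 1 0) σ)) (decode-⌜⌝ (restrict g n)))
                             (trans (cong fst (state n)) (fst-pair (∏< compatibleAt n) ⌜ restrict g n ⌝))
      where
      state : ∀ n → foldl (readEntry χ) (pair 1 0) (restrict g n) ≡ pair (∏< compatibleAt n) ⌜ restrict g n ⌝
      state zero    = refl
      state (suc n) = begin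
        foldl (readEntry χ) (pair 1 0) (restrict g (suc n))
          ≡⟨ foldl-restrict (readEntry χ) (pair 1 0) g n ⟩
        readEntry χ (foldl (readEntry χ) (pair 1 0) (restrict g n)) (g n)
          ≡⟨ cong (λ st → readEntry χ st (g n)) (state n) ⟩
        readEntry χ (pair (∏< compatibleAt n) ⌜ restrict g n ⌝) (g n)
          ≡⟨ cong₂ (λ a σ → pair (a * compatible χ (g n) σ) (snoc σ (g n)))
                   (fst-pair (∏< compatibleAt n) ⌜ restrict g n ⌝) (snd-pair (∏< compatibleAt n) ⌜ restrict g n ⌝) ⟩
        pair (∏< compatibleAt (suc n)) (snoc ⌜ restrict g n ⌝ (g n))
          ≡⟨ cong (pair (∏< compatibleAt (suc n))) (snoc-⌜⌝ (restrict g n) (g n)) ⟩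
        pair (∏< compatibleAt (suc n)) ⌜ restrict g (suc n) ⌝
          ∎
        where open ≡-Reasoning

    compatibleAt≡ : ∀ k → compatibleAt k ≡ χ (snd (g k)) * ∏< (λ j → consistent (g k) (g j)) k
                                            * (⌜ restrict g k ⌝ ⇒ℕ sg (∑< (λ j → adjacent (g k) (g j)) k))
    compatibleAt≡ k = cong₂ (λ a b → χ (snd (g k)) * a * (⌜ restrict g k ⌝ ⇒ℕ sg b))
      (trans (cong (foldl (λ acc a → acc * consistent (g k) a) 1) (decode-⌜⌝ (restrict g k)))
             (foldl-*-restrict (consistent (g k)) g k))
      (trans (cong (foldl (λ acc a → acc + adjacent (g k) a) 0) (decode-⌜⌝ (restrict g k)))
             (foldl-+-restrict (adjacent (g k)) g k))

    Attached : ℕ → Set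
    Attached k = 0 < k → Σ ℕ λ j → j < k × Adj (entryPoint (g k)) (entryPoint (g j))

    attached⇒ : ∀ k → ⌜ restrict g k ⌝ ⇒ℕ sg (∑< (λ j → adjacent (g k) (g j)) k) ≡ 1 → Attached k
    attached⇒ (suc k′) eq _
      with ∑<>0⇒ (suc k′) (sg≡1⇒>0 _ (trans (sym (pos-⇒ℕ (⌜∷ʳ⌝>0 (restrict g k′) (g k′)))) eq))
    ... | j , j<k , adj>0 = j , j<k , adjacent>0⇒Adj (g (suc k′)) (g j) adj>0

    attached⇐ : ∀ k → Attached k → ⌜ restrict g k ⌝ ⇒ℕ sg (∑< (λ j → adjacent (g k) (g j)) k) ≡ 1
    attached⇐ zero     _  = refl
    attached⇐ (suc k′) at with at (s≤s z≤n)
    ... | j , j<k , adj = trans (pos-⇒ℕ (⌜∷ʳ⌝>0 (restrict g k′) (g k′)))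
                                (>0⇒sg≡1 (∑<>0⇐ (suc k′) j j<k (Adj⇒adjacent>0 (g (suc k′)) (g j) adj)))

    record Compatible (k : ℕ) : Set where
      field
        tile∈           : χ (snd (g k)) ≡ 1
        consistent-with : ∀ j → j < k → Consistent (g k) (g j)
        attached        : Attached k

    compatibleAt≡1⇒ : ∀ k → compatibleAt k ≡ 1 → Compatible k
    compatibleAt≡1⇒ k eq = record
      { tile∈           = proj₁ ab≡1
      ; consistent-with = λ j j<k → consistent≡1⇒ (g k) (g j) (∏<≡1⇒ _ k (proj₂ ab≡1) j j<k)
      ; attached        = attached⇒ k (proj₂ abc≡1)
      }
      where
      a b c : ℕ
      a = χ (snd (g k))
      b = ∏< (λ j → consistent (g k) (g j)) k
      c = ⌜ restrict g k ⌝ ⇒ℕ sg (∑< (λ j → adjacent (g k) (g j)) k)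
      abc≡1 : a * b ≡ 1 × c ≡ 1
      abc≡1 = *≡1⇒ (a * b) c (trans (sym (compatibleAt≡ k)) eq)
      ab≡1 : a ≡ 1 × b ≡ 1
      ab≡1 = *≡1⇒ a b (proj₁ abc≡1)

    compatibleAt≡1⇐ : ∀ k → Compatible k → compatibleAt k ≡ 1
    compatibleAt≡1⇐ k c = trans (compatibleAt≡ k) (cong₂ _*_ (cong₂ _*_ tile∈ consistent≡1) (attached⇐ k attached))
      where
      open Compatible c
      consistent≡1 : ∏< (λ j → consistent (g k) (g j)) k ≡ 1
      consistent≡1 = ∏<≡1⇐ k (λ j j<k → consistent≡1⇐ (g k) (g j) (consistent-with j j<k))

  module _ {χ : ℕ → ℕ} (χ01 : Binary χ) where

    private
      foldl-*-binary : ∀ {h : ℕ → ℕ} → (∀ a → h a ≤ 1) →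
                       ∀ acc ρ → acc ≤ 1 → foldl (λ acc a → acc * h a) acc ρ ≤ 1
      foldl-*-binary h01 acc []      acc≤1 = acc≤1
      foldl-*-binary h01 acc (a ∷ ρ) acc≤1 = foldl-*-binary h01 _ ρ (*-binary acc≤1 (h01 a))

      compatible-binary : ∀ e prev → compatible χ e prev ≤ 1
      compatible-binary e prev = *-binary
        (*-binary (χ01 (snd e)) (foldl-*-binary (consistent-binary e) 1 (decode prev) (s≤s z≤n)))
        (⇒ℕ-binary prev (sg-binary (foldl (λ acc a → acc + adjacent e a) 0 (decode prev))))

      flag : ∀ st e → fst (readEntry χ st e) ≡ fst st * compatible χ e (snd st)
      flag st e = fst-pair (fst st * compatible χ e (snd st)) (snoc (snd st) e)

      flag-binary : ∀ st ρ → fst st ≤ 1 → fst (foldl (readEntry χ) st ρ) ≤ 1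
      flag-binary st []      st≤1 = st≤1
      flag-binary st (e ∷ ρ) st≤1 = flag-binary (readEntry χ st e) ρ
        (subst (_≤ 1) (sym (flag st e)) (*-binary st≤1 (compatible-binary e (snd st))))

      flag-zero : ∀ st ρ → fst st ≡ 0 → fst (foldl (readEntry χ) st ρ) ≡ 0
      flag-zero st []      st≡0 = st≡0
      flag-zero st (e ∷ ρ) st≡0 = flag-zero (readEntry χ st e) ρ (trans (flag st e) (cong (_* compatible χ e (snd st)) st≡0))

    valid-binary : ∀ s → valid χ s ≤ 1
    valid-binary s = flag-binary (pair 1 0) (decode s) (≤-reflexive (fst-pair 1 0))

    -- Once a prefix is invalid the flag stays 0, so validity is inherited by prefixes.
    valid-IsTree : IsTree (λ s → valid χ s ≡ 1)
    valid-IsTree σ τ στ-valid with binary-cases (valid-binary ⌜ σ ⌝)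
    ... | inj₂ σ-valid   = σ-valid
    ... | inj₁ σ-invalid = ⊥-elim (0≢1+n (trans (sym (flag-zero prefixState τ prefix≡0)) extension≡1))
      where
      prefixState : ℕ
      prefixState = foldl (readEntry χ) (pair 1 0) σ
      prefix≡0 : fst prefixState ≡ 0
      prefix≡0 = trans (cong (λ ρ → fst (foldl (readEntry χ) (pair 1 0) ρ)) (sym (decode-⌜⌝ σ))) σ-invalid
      extension≡1 : fst (foldl (readEntry χ) prefixState τ) ≡ 1
      extension≡1 = trans (cong fst (sym (foldl-++ (readEntry χ) (pair 1 0) σ τ)))
                          (trans (cong (λ ρ → fst (foldl (readEntry χ) (pair 1 0) ρ)) (sym (decode-⌜⌝ (σ ++ τ)))) στ-valid)

  module _ {χ : ℕ → ℕ} {g : ℕ → ℕ} where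

    compatible⇒valid : (∀ k → Compatible χ g k) → ∀ n → valid χ ⌜ restrict g n ⌝ ≡ 1
    compatible⇒valid compatible n =
      trans (valid-restrict χ g n) (∏<≡1⇐ n (λ k _ → compatibleAt≡1⇐ χ g k (compatible k)))

    valid⇒compatible : (∀ n → valid χ ⌜ restrict g n ⌝ ≡ 1) → ∀ k → Compatible χ g k
    valid⇒compatible onPath k =
      compatibleAt≡1⇒ χ g k (∏<≡1⇒ _ (suc k) (trans (sym (valid-restrict χ g (suc k))) (onPath (suc k))) k ≤-refl)

module PathToRegion where

  open import Level using (0ℓ)
  open Coding
  open Entries
  open PartialTilings
  open Reductions using (Ones)
  open BranchTiles using (TreeWithPath)
  open Grid
  open import Data.Nat
  open import Data.Nat.Properties
  open import Data.Fin using (Fin; toℕ)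
  open import Data.Fin.Properties using (pigeonhole; any?)
  open import Data.Integer as ℤ using (ℤ)
  import Data.Integer.Properties as ℤ
  open import Data.List using (length; lookup)
  open import Data.List.Relation.Unary.Any using (index)
  open import Data.List.Relation.Unary.Any.Properties using (lookup-index)
  open import Data.List.Membership.Propositional using (_∈_)
  open import Data.Product using (Σ; _,_; proj₁; proj₂)
  open import Data.Product.Properties using (≡-dec)
  open import Data.List.Membership.DecPropositional (≡-dec ℤ._≟_ ℤ._≟_) using (_∈?_)
  open import Data.Empty using (⊥; ⊥-elim)
  open import Relation.Unary using (Pred)
  open import Relation.Nullary using (yes; no; ¬?)
  open import Relation.Nullary.Decidable using (decidable-stable)
  open import Relation.Binary.Definitions using (tri<; tri≈; tri>)
  open import Relation.Binary.PropositionalEquality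

  Range : (ℕ → Point) → Pred Point 0ℓ
  Range Q p = Σ ℕ λ n → Q n ≡ p

  -- Among Q 0, …, Q (length l) one point is missing from l, or two of them coincide.
  Range-infinite : ∀ Q → (∀ n j → j < n → Q n ≢ Q j) → Infinite (Range Q)
  Range-infinite Q injective l with any? (λ (i : Fin (suc (length l))) → ¬? (Q (toℕ i) ∈? l))
  ... | yes (i , Qi∉l) = Q (toℕ i) , (toℕ i , refl) , Qi∉l
  ... | no  none = ⊥-elim (collision (λ i → decidable-stable (Q (toℕ i) ∈? l) (λ Qi∉l → none (i , Qi∉l))))
    where
    collision : (∀ (i : Fin (suc (length l))) → Q (toℕ i) ∈ l) → ⊥
    collision member with pigeonhole (n<1+n (length l)) (λ i → index (member i))
    ... | i , j , i<j , same-index = injective (toℕ j) (toℕ i) i<j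
      (trans (lookup-index (member j)) (trans (cong (lookup l) (sym same-index)) (sym (lookup-index (member i)))))

  private
    i≢i+1 : ∀ {i} → i ≢ i ℤ.+ ℤ.1ℤ
    i≢i+1 {i} eq = ℤ.i≢suc[i] (trans eq (ℤ.+-comm i ℤ.1ℤ))

  module _ {χ : ℕ → ℕ} (g : ℕ → ℕ) (compatible : ∀ k → Compatible χ g k) where

    Q : ℕ → Point
    Q n = entryPoint (g n)

    T : ℕ → Tile
    T n = entryTile (g n)

    distinct : ∀ n j → j < n → Q n ≢ Q j
    distinct n j j<n Qn≡Qj = Consistent.distinct (Compatible.consistent-with (compatible n) j j<n) (sym Qn≡Qj)

    matching : ∀ n m → n ≢ m → Matches (Q n) (T n) (Q m) (T m)
    matching n m n≢m with <-cmp n m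
    ... | tri< n<m _ _ = Consistent.matches← (Compatible.consistent-with (compatible m) n n<m)
    ... | tri≈ _ n≡m _ = ⊥-elim (n≢m n≡m)
    ... | tri> _ _ m<n = Consistent.matches→ (Compatible.consistent-with (compatible n) m m<n)

    toOrigin : ∀ k n → n < k → GridPath (Range Q) (Q n) (Q 0)
    toOrigin (suc k) zero    _         = here (0 , refl)
    toOrigin (suc k) (suc n) (s≤s n<k) with Compatible.attached (compatible (suc n)) (s≤s z≤n)
    ... | j , j≤n , adj = step (suc n , refl) adj (toOrigin k j (≤-trans j≤n n<k))

    Range-connected : Connected (Range Q)
    Range-connected _ _ (n , refl) (m , refl) = toOrigin (suc n) n ≤-refl ++ᴳ GridPath-reverse (toOrigin (suc m) m ≤-refl)

    regionTiling : TilesInfiniteConnected (λ x → χ x ≡ 1)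
    regionTiling = Range Q , Range-infinite Q distinct , Range-connected , (λ _ r → T (proj₁ r)) ,
                   inS , horizontal , vertical
      where
      inS : ∀ p (r : Range Q p) → χ (tileCode (T (proj₁ r))) ≡ 1
      inS _ (n , _) = trans (cong χ (tileCode-decodeTile (snd (g n)))) (Compatible.tile∈ (compatible n))
      horizontal : MatchesHorizontally {Range Q} λ _ r → T (proj₁ r)
      horizontal x y (n , Qn≡) (m , Qm≡) = proj₁ (matching n m n≢m) (RightOf-at Qn≡ Qm≡)
        where
        n≢m : n ≢ m
        n≢m refl = i≢i+1 (cong proj₁ (trans (sym Qn≡) Qm≡))
      vertical : MatchesVertically {Range Q} λ _ r → T (proj₁ r)
      vertical x y (n , Qn≡) (m , Qm≡) = proj₂ (matching n m n≢m) (Above-at Qn≡ Qm≡)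
        where
        n≢m : n ≢ m
        n≢m refl = i≢i+1 (cong proj₂ (trans (sym Qn≡) Qm≡))

  validBranch⇒tiling : ∀ {χ} → TreeWithPath (Ones (valid χ)) → TilesInfiniteConnected (Ones χ)
  validBranch⇒tiling {χ} (_ , g , onPath) = regionTiling g (valid⇒compatible {χ} onPath)

module RegionToPath where

  open import Level using (0ℓ)
  open Entries
  open PartialTilings
  open TruthValues using (Binary)
  open Reductions using (Ones)
  open BranchTiles using (TreeWithPath)
  open Grid
  open import Data.Nat
  open import Data.Nat.Properties
  import Data.Integer as ℤ
  import Data.Integer.Properties as ℤ
  open import Data.List using (List; []; _∷_; _++_; _∷ʳ_; map; length)
  open import Data.List.Properties using (map-++)
  open import Data.List.Relation.Unary.Any using (here)
  open import Data.List.Membership.Propositional using (_∈_; _∉_)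
  open import Data.List.Membership.Propositional.Properties using (∈-++⁻; ∈-++⁺ˡ; ∈-++⁺ʳ)
  open import Data.Product using (Σ; _×_; _,_; proj₁; proj₂)
  open import Data.Product.Properties using (≡-dec)
  open import Data.List.Membership.DecPropositional (≡-dec ℤ._≟_ ℤ._≟_) using (_∈?_)
  open import Data.Sum using (_⊎_; inj₁; inj₂)
  open import Data.Empty using (⊥-elim)
  open import Function using (_∘_)
  open import Relation.Unary using (Pred)
  open import Relation.Nullary using (yes; no)
  open import Relation.Binary.PropositionalEquality

  module _ {R : Pred Point 0ℓ} where

    exit : ∀ {p q} (visited : List Point) → GridPath R p q → p ∈ visited → q ∉ visited →
           Σ Point λ p′ → R p′ × p′ ∉ visited × Σ Point λ w → w ∈ visited × Adj w p′
    exit visited (here _) p∈ q∉ = ⊥-elim (q∉ p∈)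
    exit {p} visited (step {p' = p′} _ a π) p∈ q∉ with p′ ∈? visited
    ... | yes p′∈ = exit visited π p′∈ q∉
    ... | no  p′∉ = p′ , GridPath-source π , p′∉ , p , p∈ , a

  module _ {R : Pred Point 0ℓ} (R-infinite : Infinite R) (R-connected : Connected R) where

    Member : Set
    Member = Σ Point R

    points : List Member → List Point
    points = map proj₁

    AttachedTo : List Member → Point → Set
    AttachedTo ms p = 0 < length ms → Σ Point λ w → w ∈ points ms × Adj w p

    nextMember : ∀ ms → Σ Member λ m → proj₁ m ∉ points ms × AttachedTo ms (proj₁ m)
    nextMember [] with R-infinite []
    ... | p , r , _ = (p , r) , (λ ()) , λ ()
    nextMember ((p₀ , r₀) ∷ ms) with R-infinite (points ((p₀ , r₀) ∷ ms))
    ... | q , r , q∉ with exit (points ((p₀ , r₀) ∷ ms)) (R-connected p₀ q r₀ r) (here refl) q∉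
    ...   | p′ , r′ , p′∉ , w , w∈ , adj = (p′ , r′) , p′∉ , λ _ → w , w∈ , adj

    visited : ℕ → List Member
    visited zero    = []
    visited (suc n) = visited n ∷ʳ proj₁ (nextMember (visited n))

    point : ℕ → Point
    point n = proj₁ (proj₁ (nextMember (visited n)))

    point∈R : ∀ n → R (point n)
    point∈R n = proj₂ (proj₁ (nextMember (visited n)))

    points-visited : ∀ n → points (visited (suc n)) ≡ points (visited n) ++ point n ∷ []
    points-visited n = map-++ proj₁ (visited n) _

    ∈-visited⇒ : ∀ n {x} → x ∈ points (visited n) → Σ ℕ λ j → j < n × x ≡ point j
    ∈-visited⇒ (suc n) x∈ with ∈-++⁻ (points (visited n)) (subst (_ ∈_) (points-visited n) x∈)
    ... | inj₁ x∈′        = let (j , j<n , x≡) = ∈-visited⇒ n x∈′ in j , m≤n⇒m≤1+n j<n , x≡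
    ... | inj₂ (here x≡) = n , ≤-refl , x≡

    ∈-visited⇐ : ∀ n j → j < n → point j ∈ points (visited n)
    ∈-visited⇐ (suc n) j (s≤s j≤n) = subst (point j ∈_) (sym (points-visited n)) (case (m≤n⇒m<n∨m≡n j≤n))
      where
      case : j < n ⊎ j ≡ n → point j ∈ points (visited n) ++ point n ∷ []
      case (inj₁ j<n)  = ∈-++⁺ˡ (∈-visited⇐ n j j<n)
      case (inj₂ refl) = ∈-++⁺ʳ (points (visited n)) (here refl)

    point-fresh : ∀ n j → j < n → point n ≢ point j
    point-fresh n j j<n same = proj₁ (proj₂ (nextMember (visited n))) (subst (_∈ _) (sym same) (∈-visited⇐ n j j<n))

    point-attached : ∀ n → 0 < n → Σ ℕ λ j → j < n × Adj (point j) (point n)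
    point-attached (suc n) _ with proj₂ (proj₂ (nextMember (visited (suc n)))) (nonempty (visited n))
      where
      nonempty : ∀ ms → 0 < length (ms ∷ʳ proj₁ (nextMember (visited n)))
      nonempty []      = s≤s z≤n
      nonempty (_ ∷ _) = s≤s z≤n
    ... | w , w∈ , adj with ∈-visited⇒ (suc n) w∈
    ...   | j , j<n , refl = j , j<n , adj

  module _ {χ : ℕ → ℕ} {R : Pred Point 0ℓ} (R-infinite : Infinite R) (R-connected : Connected R)
           (f : (p : Point) → R p → Tile) (inS : ∀ p r → χ (tileCode (f p r)) ≡ 1)
           (horizontal : MatchesHorizontally f) (vertical : MatchesVertically f)
           where

    tiling-matches : ∀ p p′ (r : R p) (r′ : R p′) → Matches p (f p r) p′ (f p′ r′)
    tiling-matches (x , y) _ r r′ = (λ { (refl , refl) → horizontal x y r r′ }) , (λ { (refl , refl) → vertical x y r r′ })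

    tileAt : ℕ → Tile
    tileAt n = f (point R-infinite R-connected n) (point∈R R-infinite R-connected n)

    enumeration : ℕ → ℕ
    enumeration n = entry (point R-infinite R-connected n) (tileAt n)

    enumeration-compatible : ∀ k → Compatible χ enumeration k
    enumeration-compatible k = record
      { tile∈           = trans (cong χ (snd-entry (point R-infinite R-connected k) (tileAt k)))
                                (inS _ (point∈R R-infinite R-connected k))
      ; consistent-with = λ j j<k → Consistent-entry (point-fresh R-infinite R-connected k j j<k ∘ sym)
                                      (tiling-matches _ _ _ _) (tiling-matches _ _ _ _)
      ; attached        = λ k>0 → let (j , j<k , adj) = point-attached R-infinite R-connected k k>0 in
                            j , j<k , subst₂ Adj (sym (entryPoint-entry _ (tileAt k))) (sym (entryPoint-entry _ (tileAt j)))
                                             (Adj-sym adj)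
      }

  tiling⇒validBranch : ∀ {χ} → Binary χ → TilesInfiniteConnected (Ones χ) → TreeWithPath (Ones (valid χ))
  tiling⇒validBranch {χ} χ01 (_ , inf , conn , f , inS , horizontal , vertical) =
    valid-IsTree χ01 , enumeration {χ} inf conn f inS horizontal vertical ,
    compatible⇒valid (enumeration-compatible {χ} inf conn f inS horizontal vertical)

open Reductions
open BranchTiles
open PathToRow
open RowToPath
open PartialTilings
open RegionToPath
open PathToRegion
open import Data.Product using (_,_)

TreeWithPath-extensional : Extensional TreeWithPath
TreeWithPath-extensional (S⊆S′ , S′⊆S) (tree , g , onPath) =
  (λ σ τ στ∈S′ → S⊆S′ (tree σ τ (S′⊆S στ∈S′))) , g , (λ n → S⊆S′ (onPath n))

Tiles-extensional : Extensional TilesInfiniteConnected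
Tiles-extensional (S⊆S′ , _) (R , inf , conn , f , inS , horizontal , vertical) =
  R , inf , conn , f , (λ p r → S⊆S′ (inS p r)) , horizontal , vertical

ILL≤mWTILE : ILL ≤m WTILE
ILL≤mWTILE = CharSet-≤m TreeWithPath-extensional Tiles-extensional acceptsᴼ (λ _ → accepts-binary)
  (λ _ → treeWithPath⇒rowTiling) (λ χ _ → tiling⇒treeWithPath {χ})

WTILE≤mILL : WTILE ≤m ILL
WTILE≤mILL = CharSet-≤m Tiles-extensional TreeWithPath-extensional validᴼ (λ _ → valid-binary)
  (λ _ → tiling⇒validBranch) (λ χ _ → validBranch⇒tiling {χ})

mainTheorem4 : WTILE ≡m ILL
mainTheorem4 = WTILE≤mILL , ILL≤mWTILE
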